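{- For every term $\tau$ of the language of $\mathbf{CLA4}$ not containing the variable $z$, $\mathbf{CLA4}$ proves the $\sqcap$-closure of $\sqcup z\,(z=\tau)$.
   Context: Language of $\mathbf{CLA4}$. Terms are built from variables, the constant $0$, unary $'$ (successor), binary $+$, $\times$; atomic formulas are $\tau_1=\tau_2$. Formulas are built from atoms with $\top,\bot$, $\neg$ (officially applied only to atoms; elsewhere via De Morgan laws and double negation), $\wedge,\vee$, choice connectives $\sqcap,\sqcup$, and quantifiers $\forall,\exists$ (blind) and $\sqcap x,\sqcup x$ (choice). $E\to F$ abbreviates $\neg E\vee F$. Elementary formulas are those without $\sqcap,\sqcup$ (formulas of Peano arithmetic $\mathbf{PA}$). $\tau 0$ abbreviates $0''\times\tau$ and $\tau1$ abbreviates $(0''\times\tau)'$. $|x|$ denotes the length $\lceil\log_2(x+1)\rceil$ of the binary numeral of $x$; expressions involving $|x|$ abbreviate standard $\mathbf{PA}$ formulas. A polynomial sizebound for $x$ is a $\mathbf{PA}$ formula expressing $|x|\le\tau(|y_1|,\ldots,|y_n|)$, with the $y_i$ variables other than $x$ and $\tau$ built from $0,',+,\times$. A formula is polynomially bounded iff each subformula $\sqcap xG(x)$ has $G(x)$ of the form $S(x)\to H(x)$ and each subformula $\sqcup xG(x)$ has $G(x)$ of the form $S(x)\wedge H(x)$, $S(x)$ a polynomial sizebound for $x$. The $\sqcap$-closure ($\forall$-closure) prefixes $\sqcap$ ($\forall$) over all free variables. Logic $\mathbf{CL12}$. A sequent is $E_1,\ldots,E_n\circ\!\!-F$. The elementarization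 $\|F\|$ replaces every $\sqcup$- and $\sqcup x$-subformula by $\bot$ and every $\sqcap$- and $\sqcap x$-subformula by $\top$; the elementarization of a sequent is $\|E_1\|\wedge\ldots\wedge\|E_n\|\to\|F\|$; a sequent is stable iff its elementarization is classically valid (first-order logic with identity). A surface occurrence is one not in the scope of a choice operator; $F[E]$ denotes a formula with a fixed surface occurrence of $E$. Rules ($i\in\{0,1\}$; $\mathfrak t$ a constant or a variable not bound in the premise): $\sqcup$-Choose: $\vec G\circ\!\!-F[H_i]\,/\,\vec G\circ\!\!-F[H_0\sqcup H_1]$; $\sqcap$-Choose: $\vec G,E[H_i],\vec K\circ\!\!-F\,/\,\vec G,E[H_0\sqcap H_1],\vec K\circ\!\!-F$; $\sqcup x$-Choose: $\vec G\circ\!\!-F[H(\mathfrak t)]\,/\,\vec G\circ\!\!-F[\sqcup xH(x)]$; $\sqcap x$-Choose: $\vec G,E[H(\mathfrak t)],\vec K\circ\!\!-F\,/\,\vec G,E[\sqcap xH(x)],\vec K\circ\!\!-F$; Replicate: $\vec G,E,\vec K,E\circ\!\!-F\,/\,\vec G,E,\vec K\circ\!\!-F$; Wait: from $Y_1,\ldots,Y_n$ ($n\ge0$) infer a stable $X$ provided: if $X$ is $\vec G\circ\!\!-F[H_0\sqcap H_1]$ then $\vec G\circ\!\!-F[H_0]$, $\vec G\circ\!\!-F[H_1]$ are among the $Y_j$; if $X$ is $\vec G,E[H_0\sqcup H_1],\vec K\circ\!\!-F$ then $\vec G,E[H_0],\vec K\circ\!\!-F$, $\vec G,E[H_1],\vec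 K\circ\!\!-F$ are among the $Y_j$; if $X$ is $\vec G\circ\!\!-F[\sqcap xH(x)]$ then $\vec G\circ\!\!-F[H(y)]$ is among the $Y_j$ for some $y$ not in $X$; if $X$ is $\vec G,E[\sqcup xH(x)],\vec K\circ\!\!-F$ then $\vec G,E[H(y)],\vec K\circ\!\!-F$ is among the $Y_j$ for some $y$ not in $X$. System $\mathbf{CLA4}$. Axioms: $\forall x(0\neq x')$; $\forall x\forall y(x'=y'\to x=y)$; $\forall x(x+0=x)$; $\forall x\forall y(x+y'=(x+y)')$; $\forall x(x\times0=0)$; $\forall x\forall y(x\times y'=(x\times y)+x)$; the $\forall$-closure of $F(0)\wedge\forall x(F(x)\to F(x'))\to\forall xF(x)$ for each elementary $F(x)$; $\sqcap x\sqcup y(y=x')$; $\sqcap x\sqcup y(y=x0)$. Rules: Logical Consequence (from sentences $E_1,\ldots,E_n$ infer a sentence $F$ whenever $\mathbf{CL12}$ proves $E_1,\ldots,E_n\circ\!\!-F$), and $\mathbf{CLA4}$-Induction: from the $\sqcap$-closures of $F(0)$, $F(x)\to F(x0)$, $F(x)\to F(x1)$ infer the $\sqcap$-closure of $F(x)$, for polynomially bounded $F(x)$. A sentence is provable in $\mathbf{CLA4}$ iff there is a finite sequence of sentences, each an axiom or obtained from earlier ones by a rule, ending with it. -}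

module Defs where

open import Data.Nat using (ℕ; zero; suc; _+_; _*_; _≤_; _≟_)
open import Data.Nat.Logarithm using (⌈log₂_⌉)
open import Data.Bool using (Bool; true; false; if_then_else_)
open import Data.List using (List; []; _∷_; _++_; [_]; map; foldr; deduplicate)
open import Data.List.Membership.Propositional using (_∈_)
open import Data.Product using (Σ; _×_; _,_)
open import Data.Sum using (_⊎_)
open import Data.Unit using (⊤; tt)
open import Data.Empty using (⊥)
open import Relation.Nullary using (¬_; does)
open import Relation.Binary.PropositionalEquality using (_≡_)
open import Function using (_⇔_)

Var : Set
Var = ℕ

data Term : Set where
  var  : Var → Term
  ‘0’  : Term
  _′   : Term → Term
  _⊕_  : Term → Term → Term
  _⊗_  : Term → Term → Term

-- Formulas in negation normal form: ¬ is applied to atoms only.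
data Formula : Set where
  ⊤'   : Formula
  ⊥'   : Formula
  _≐_  : Term → Term → Formula
  _≠_  : Term → Term → Formula
  _∧'_ : Formula → Formula → Formula
  _∨'_ : Formula → Formula → Formula
  _⊓_  : Formula → Formula → Formula
  _⊔_  : Formula → Formula → Formula
  ∀'   : Var → Formula → Formula
  ∃'   : Var → Formula → Formula
  ⊓x   : Var → Formula → Formula
  ⊔x   : Var → Formula → Formula

neg : Formula → Formula
neg ⊤' = ⊥'
neg ⊥' = ⊤'
neg (t ≐ u) = t ≠ u
neg (t ≠ u) = t ≐ u
neg (A ∧' B) = neg A ∨' neg B
neg (A ∨' B) = neg A ∧' neg B
neg (A ⊓ B) = neg A ⊔ neg B
neg (A ⊔ B) = neg A ⊓ neg B
neg (∀' x A) = ∃' x (neg A)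
neg (∃' x A) = ∀' x (neg A)
neg (⊓x x A) = ⊔x x (neg A)
neg (⊔x x A) = ⊓x x (neg A)

_⇒_ : Formula → Formula → Formula
E ⇒ F = neg E ∨' F

two : Term
two = (‘0’ ′) ′

_·0 : Term → Term
t ·0 = two ⊗ t

_·1 : Term → Term
t ·1 = (two ⊗ t) ′

eqb : Var → Var → Bool
eqb x y = does (x ≟ y)

freeT : Term → List Var
freeT (var x) = x ∷ []
freeT ‘0’ = []
freeT (t ′) = freeT t
freeT (t ⊕ u) = freeT t ++ freeT u
freeT (t ⊗ u) = freeT t ++ freeT u

remove : Var → List Var → List Var
remove x [] = []
remove x (y ∷ ys) = if eqb x y then remove x ys else y ∷ remove x ys

free : Formula → List Var
free ⊤' = []
free ⊥' = []
free (t ≐ u) = freeT t ++ freeT u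
free (t ≠ u) = freeT t ++ freeT u
free (A ∧' B) = free A ++ free B
free (A ∨' B) = free A ++ free B
free (A ⊓ B) = free A ++ free B
free (A ⊔ B) = free A ++ free B
free (∀' x A) = remove x (free A)
free (∃' x A) = remove x (free A)
free (⊓x x A) = remove x (free A)
free (⊔x x A) = remove x (free A)

bound : Formula → List Var
bound ⊤' = []
bound ⊥' = []
bound (t ≐ u) = []
bound (t ≠ u) = []
bound (A ∧' B) = bound A ++ bound B
bound (A ∨' B) = bound A ++ bound B
bound (A ⊓ B) = bound A ++ bound B
bound (A ⊔ B) = bound A ++ bound B
bound (∀' x A) = x ∷ bound A
bound (∃' x A) = x ∷ bound A
bound (⊓x x A) = x ∷ bound A
bound (⊔x x A) = x ∷ bound A

vars : Formula → List Var
vars F = free F ++ bound F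

Sentence : Formula → Set
Sentence F = free F ≡ []

freeDistinct : Formula → List Var
freeDistinct F = deduplicate _≟_ (free F)

⊓closure : Formula → Formula
⊓closure F = foldr ⊓x F (freeDistinct F)

∀closure : Formula → Formula
∀closure F = foldr ∀' F (freeDistinct F)

-- substitution of a term for the free occurrences of a variable
-- (naive; only used where no capture can occur)
substT : Var → Term → Term → Term
substT x s (var y) = if eqb x y then s else var y
substT x s ‘0’ = ‘0’
substT x s (t ′) = substT x s t ′
substT x s (t ⊕ u) = substT x s t ⊕ substT x s u
substT x s (t ⊗ u) = substT x s t ⊗ substT x s u

subst : Var → Term → Formula → Formula
subst x s ⊤' = ⊤'
subst x s ⊥' = ⊥'
subst x s (t ≐ u) = substT x s t ≐ substT x s u
subst x s (t ≠ u) = substT x s t ≠ substT x s u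
subst x s (A ∧' B) = subst x s A ∧' subst x s B
subst x s (A ∨' B) = subst x s A ∨' subst x s B
subst x s (A ⊓ B) = subst x s A ⊓ subst x s B
subst x s (A ⊔ B) = subst x s A ⊔ subst x s B
subst x s (∀' y A) = ∀' y (if eqb x y then A else subst x s A)
subst x s (∃' y A) = ∃' y (if eqb x y then A else subst x s A)
subst x s (⊓x y A) = ⊓x y (if eqb x y then A else subst x s A)
subst x s (⊔x y A) = ⊔x y (if eqb x y then A else subst x s A)

Elementary : Formula → Set
Elementary ⊤' = ⊤
Elementary ⊥' = ⊤
Elementary (t ≐ u) = ⊤
Elementary (t ≠ u) = ⊤
Elementary (A ∧' B) = Elementary A × Elementary B
Elementary (A ∨' B) = Elementary A × Elementary B
Elementary (A ⊓ B) = ⊥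
Elementary (A ⊔ B) = ⊥
Elementary (∀' x A) = Elementary A
Elementary (∃' x A) = Elementary A
Elementary (⊓x x A) = ⊥
Elementary (⊔x x A) = ⊥

‖_‖ : Formula → Formula
‖ ⊤' ‖ = ⊤'
‖ ⊥' ‖ = ⊥'
‖ t ≐ u ‖ = t ≐ u
‖ t ≠ u ‖ = t ≠ u
‖ A ∧' B ‖ = ‖ A ‖ ∧' ‖ B ‖
‖ A ∨' B ‖ = ‖ A ‖ ∨' ‖ B ‖
‖ A ⊓ B ‖ = ⊤'
‖ A ⊔ B ‖ = ⊥'
‖ ∀' x A ‖ = ∀' x ‖ A ‖
‖ ∃' x A ‖ = ∃' x ‖ A ‖
‖ ⊓x x A ‖ = ⊤'
‖ ⊔x x A ‖ = ⊥'

-- Classical semantics (first-order logic with identity), via the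
-- Goedel–Gentzen negative interpretation into Set.

record Structure : Set₁ where
  field
    D    : Set
    zer  : D
    suc' : D → D
    add  : D → D → D
    mul  : D → D → D
open Structure

evalT : (M : Structure) → (Var → D M) → Term → D M
evalT M ρ (var x) = ρ x
evalT M ρ ‘0’ = zer M
evalT M ρ (t ′) = suc' M (evalT M ρ t)
evalT M ρ (t ⊕ u) = add M (evalT M ρ t) (evalT M ρ u)
evalT M ρ (t ⊗ u) = mul M (evalT M ρ t) (evalT M ρ u)

update : {A : Set} → (Var → A) → Var → A → (Var → A)
update ρ x d y = if eqb x y then d else ρ y

-- Classical truth of a formula (choice operators read as in the
-- elementarization: ⊓ as ⊤ and ⊔ as ⊥; only applied to elementary formulas).
Sat : (M : Structure) → (Var → D M) → Formula → Set
Sat M ρ ⊤' = ⊤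
Sat M ρ ⊥' = ⊥
Sat M ρ (t ≐ u) = ¬ ¬ (evalT M ρ t ≡ evalT M ρ u)
Sat M ρ (t ≠ u) = ¬ (evalT M ρ t ≡ evalT M ρ u)
Sat M ρ (A ∧' B) = Sat M ρ A × Sat M ρ B
Sat M ρ (A ∨' B) = ¬ (¬ Sat M ρ A × ¬ Sat M ρ B)
Sat M ρ (A ⊓ B) = ⊤
Sat M ρ (A ⊔ B) = ⊥
Sat M ρ (∀' x A) = (d : D M) → Sat M (update ρ x d) A
Sat M ρ (∃' x A) = ¬ ((d : D M) → ¬ Sat M (update ρ x d) A)
Sat M ρ (⊓x x A) = ⊤
Sat M ρ (⊔x x A) = ⊥

Valid : Formula → Set₁
Valid F = (M : Structure) (ρ : Var → D M) → Sat M ρ F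

ℕ-model : Structure
ℕ-model = record { D = ℕ ; zer = zero ; suc' = suc ; add = _+_ ; mul = _*_ }

-- |x| = ⌈log₂(x+1)⌉, the length of the binary numeral of x
∣_∣ : ℕ → ℕ
∣ x ∣ = ⌈log₂ suc x ⌉

evalℕ : (Var → ℕ) → Term → ℕ
evalℕ = evalT ℕ-model

SizeBound : Var → Formula → Set
SizeBound x S =
  Elementary S ×
  Σ Term λ τ → (¬ (x ∈ freeT τ)) ×
    ((ρ : Var → ℕ) → Sat ℕ-model ρ S ⇔ (∣ ρ x ∣ ≤ evalℕ (λ v → ∣ ρ v ∣) τ))

PolyBounded : Formula → Set
PolyBounded ⊤' = ⊤
PolyBounded ⊥' = ⊤
PolyBounded (t ≐ u) = ⊤
PolyBounded (t ≠ u) = ⊤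
PolyBounded (A ∧' B) = PolyBounded A × PolyBounded B
PolyBounded (A ∨' B) = PolyBounded A × PolyBounded B
PolyBounded (A ⊓ B) = PolyBounded A × PolyBounded B
PolyBounded (A ⊔ B) = PolyBounded A × PolyBounded B
PolyBounded (∀' x A) = PolyBounded A
PolyBounded (∃' x A) = PolyBounded A
PolyBounded (⊓x x A) =
  PolyBounded A × Σ Formula λ S → Σ Formula λ H → SizeBound x S × (A ≡ (S ⇒ H))
PolyBounded (⊔x x A) =
  PolyBounded A × Σ Formula λ S → Σ Formula λ H → SizeBound x S × (A ≡ (S ∧' H))

-- contexts F[–] whose hole is a surface occurrence
data Ctx : Set where
  ∙    : Ctx
  _∧ₗ_ : Ctx → Formula → Ctx
  _∧ᵣ_ : Formula → Ctx → Ctx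
  _∨ₗ_ : Ctx → Formula → Ctx
  _∨ᵣ_ : Formula → Ctx → Ctx
  ∀c   : Var → Ctx → Ctx
  ∃c   : Var → Ctx → Ctx

_⟦_⟧ : Ctx → Formula → Formula
∙ ⟦ E ⟧ = E
(C ∧ₗ B) ⟦ E ⟧ = (C ⟦ E ⟧) ∧' B
(A ∧ᵣ C) ⟦ E ⟧ = A ∧' (C ⟦ E ⟧)
(C ∨ₗ B) ⟦ E ⟧ = (C ⟦ E ⟧) ∨' B
(A ∨ᵣ C) ⟦ E ⟧ = A ∨' (C ⟦ E ⟧)
∀c x C ⟦ E ⟧ = ∀' x (C ⟦ E ⟧)
∃c x C ⟦ E ⟧ = ∃' x (C ⟦ E ⟧)

infix 4 _∘-_
data Sequent : Set where
  _∘-_ : List Formula → Formula → Sequent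

seqFormulas : Sequent → List Formula
seqFormulas (Γ ∘- F) = F ∷ Γ

OccursIn : Var → Sequent → Set
OccursIn y X = Σ Formula λ E → (E ∈ seqFormulas X) × (y ∈ vars E)

BoundIn : Var → Sequent → Set
BoundIn y X = Σ Formula λ E → (E ∈ seqFormulas X) × (y ∈ bound E)

Admissible : Term → Sequent → Set
Admissible t X = (t ≡ ‘0’) ⊎ Σ Var λ y → (t ≡ var y) × ¬ BoundIn y X

conj : List Formula → Formula
conj [] = ⊤'
conj (E ∷ []) = E
conj (E ∷ Es) = E ∧' conj Es

elemSeq : Sequent → Formula
elemSeq ([] ∘- F) = ‖ F ‖
elemSeq (Γ ∘- F) = conj (map ‖_‖ Γ) ⇒ ‖ F ‖

Stable : Sequent → Set₁
Stable X = Valid (elemSeq X)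

WaitCond : Sequent → List Sequent → Set
WaitCond (Γ ∘- F) Ys =
  ((C : Ctx) (H₀ H₁ : Formula) → F ≡ C ⟦ H₀ ⊓ H₁ ⟧ →
     ((Γ ∘- C ⟦ H₀ ⟧) ∈ Ys) × ((Γ ∘- C ⟦ H₁ ⟧) ∈ Ys)) ×
  ((G K : List Formula) (C : Ctx) (H₀ H₁ : Formula) → Γ ≡ G ++ (C ⟦ H₀ ⊔ H₁ ⟧) ∷ K →
     ((G ++ (C ⟦ H₀ ⟧) ∷ K ∘- F) ∈ Ys) × ((G ++ (C ⟦ H₁ ⟧) ∷ K ∘- F) ∈ Ys)) ×
  ((C : Ctx) (x : Var) (H : Formula) → F ≡ C ⟦ ⊓x x H ⟧ →
     Σ Var λ y → ¬ OccursIn y (Γ ∘- F) × ((Γ ∘- C ⟦ subst x (var y) H ⟧) ∈ Ys)) ×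
  ((G K : List Formula) (C : Ctx) (x : Var) (H : Formula) → Γ ≡ G ++ (C ⟦ ⊔x x H ⟧) ∷ K →
     Σ Var λ y → ¬ OccursIn y (Γ ∘- F) × ((G ++ (C ⟦ subst x (var y) H ⟧) ∷ K ∘- F) ∈ Ys))

data CL12⊢ : Sequent → Set₁ where
  ⊔-choose : ∀ {G} C H₀ H₁ (i : Bool) →
    CL12⊢ (G ∘- C ⟦ (if i then H₁ else H₀) ⟧) → CL12⊢ (G ∘- C ⟦ H₀ ⊔ H₁ ⟧)
  ⊓-choose : ∀ {G K F} C H₀ H₁ (i : Bool) →
    CL12⊢ (G ++ (C ⟦ (if i then H₁ else H₀) ⟧) ∷ K ∘- F) →
    CL12⊢ (G ++ (C ⟦ H₀ ⊓ H₁ ⟧) ∷ K ∘- F)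
  ⊔x-choose : ∀ {G} C x H t →
    Admissible t (G ∘- C ⟦ subst x t H ⟧) →
    CL12⊢ (G ∘- C ⟦ subst x t H ⟧) → CL12⊢ (G ∘- C ⟦ ⊔x x H ⟧)
  ⊓x-choose : ∀ {G K F} C x H t →
    Admissible t (G ++ (C ⟦ subst x t H ⟧) ∷ K ∘- F) →
    CL12⊢ (G ++ (C ⟦ subst x t H ⟧) ∷ K ∘- F) →
    CL12⊢ (G ++ (C ⟦ ⊓x x H ⟧) ∷ K ∘- F)
  replicate : ∀ {G K F} E →
    CL12⊢ (G ++ E ∷ K ++ E ∷ [] ∘- F) → CL12⊢ (G ++ E ∷ K ∘- F)
  wait : ∀ {X} (Ys : List Sequent) →
    (∀ {Y} → Y ∈ Ys → CL12⊢ Y) → Stable X → WaitCond X Ys → CL12⊢ X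

x₀ y₀ : Var
x₀ = 0
y₀ = 1

data Axiom : Formula → Set where
  ax1 : Axiom (∀' x₀ (‘0’ ≠ (var x₀ ′)))
  ax2 : Axiom (∀' x₀ (∀' y₀ (((var x₀ ′) ≐ (var y₀ ′)) ⇒ (var x₀ ≐ var y₀))))
  ax3 : Axiom (∀' x₀ ((var x₀ ⊕ ‘0’) ≐ var x₀))
  ax4 : Axiom (∀' x₀ (∀' y₀ ((var x₀ ⊕ (var y₀ ′)) ≐ ((var x₀ ⊕ var y₀) ′))))
  ax5 : Axiom (∀' x₀ ((var x₀ ⊗ ‘0’) ≐ ‘0’))
  ax6 : Axiom (∀' x₀ (∀' y₀ ((var x₀ ⊗ (var y₀ ′)) ≐ ((var x₀ ⊗ var y₀) ⊕ var x₀))))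
  ax-ind : (x : Var) (F : Formula) → Elementary F →
    Axiom (∀closure (((subst x ‘0’ F) ∧' ∀' x (F ⇒ subst x (var x ′) F)) ⇒ ∀' x F))
  ax-suc : Axiom (⊓x x₀ (⊔x y₀ (var y₀ ≐ (var x₀ ′))))
  ax-dbl : Axiom (⊓x x₀ (⊔x y₀ (var y₀ ≐ (var x₀ ·0))))

data CLA4⊢ : Formula → Set₁ where
  axiom : ∀ {F} → Axiom F → CLA4⊢ F
  logical-consequence : (Es : List Formula) (F : Formula) →
    (∀ {E} → E ∈ Es → CLA4⊢ E) → (∀ {E} → E ∈ Es → Sentence E) → Sentence F →
    CL12⊢ (Es ∘- F) → CLA4⊢ F
  induction : (x : Var) (F : Formula) → PolyBounded F →
    CLA4⊢ (⊓closure (subst x ‘0’ F)) →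
    CLA4⊢ (⊓closure (F ⇒ subst x (var x ·0) F)) →
    CLA4⊢ (⊓closure (F ⇒ subst x (var x ·1) F)) →
    CLA4⊢ (⊓closure F)

module Submission where

-- The sentence follows by Logical Consequence from three resources: Successor
-- (an axiom), Addition and Multiplication.  A CL12 strategy answers the ⊓-closure
-- by evaluating τ bottom-up, querying a resource for every operation and naming
-- each answer by a fresh variable; the equations so collected make the final
-- choice z := (value of τ) stable.  Addition and multiplication are obtained by
-- CLA4-Induction on binary notation from the doubling axiom, halving (itself
-- proved by induction from PA) and, for multiplication, addition:
-- x + y0 = 2(⌊x/2⌋ + y) + (x mod 2), x·y0 = 2(x·y), x·y1 = 2(x·y) + x.

open import Defs
open import Data.Bool using (Bool; true; false; T; not; _∧_; if_then_else_)
open import Data.Bool.ListAction using (any)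
open import Data.Empty using (⊥; ⊥-elim)
open import Data.List using (List; []; _∷_; _++_; map; concatMap; foldr)
open import Data.List.Extrema.Nat using (max; xs≤max)
open import Data.List.Membership.Propositional using (_∈_)
open import Data.List.Membership.Propositional.Properties
  using (∈-++⁺ˡ; ∈-++⁺ʳ; ∈-++⁻; ∈-concatMap⁺; ∈-deduplicate⁺; ∈-deduplicate⁻)
open import Data.List.Properties using (++-assoc; ++-identityʳ; ∷-injective)
open import Data.List.Relation.Unary.All as All using (All; []; _∷_)
open import Data.List.Relation.Unary.All.Properties using (++⁺)
open import Data.List.Relation.Unary.AllPairs using (_∷_)
open import Data.List.Relation.Unary.Any as Any using (here; there)
open import Data.List.Relation.Unary.Any.Properties using (any⁺)
open import Data.List.Relation.Unary.Unique.Propositional using (Unique)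
open import Data.Nat using (ℕ; zero; suc; _+_; _*_; _^_; _∸_; _≤_; _<_; z≤n; s≤s; _≟_; _<?_; _≤?_; _≤ᵇ_; ⌊_/2⌋; ⌈_/2⌉)
  renaming (_⊔_ to _⊔ℕ_)
open import Data.List.Relation.Unary.Unique.DecPropositional.Properties _≟_ using (deduplicate-!)
open import Data.Nat.Divisibility using (_∣_; divides; _∣?_)
open import Data.Nat.Induction using (<-rec)
open import Data.Nat.Logarithm using (⌈log₂_⌉; ⌈log₂⌉-mono-≤; ⌈log₂2^n⌉≡n; ⌈log₂⌈n/2⌉⌉≡⌈log₂n⌉∸1)
open import Data.Nat.Primality using (prime?; euclidsLemma)
open import Data.Nat.Properties
  using (n≮n; n≤1+n; ≤-refl; ≤-reflexive; ≤-trans; ≤-<-trans; <⇒≱; ≮⇒≥; ≤⇒≤ᵇ; ≤ᵇ⇒≤; m≤m⊔n; m≤n⊔m; ⊔-lub;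
         +-suc; +-identityʳ; +-comm; +-assoc; *-comm; *-assoc; *-suc; *-identityʳ; *-distribˡ-+; *-cancelˡ-≡;
         m*n≡1⇒m≡1; m^n>0; ^-distribˡ-+-*; m∸n+n≡m; m+[n∸m]≡n; m≤m+n; m<m+n; +-mono-≤; *-mono-<; module ≤-Reasoning)
open import Data.Product as Prod using (Σ; _×_; _,_; proj₁; proj₂)
open import Data.Sum as Sum using (_⊎_; inj₁; inj₂; [_,_])
open import Data.Unit using (⊤; tt)
open import Function using (_∘_; id)
open import Function.Bundles using (mk⇔; Equivalence)
open import Relation.Binary.PropositionalEquality
  using (_≡_; _≢_; refl; sym; trans; cong; cong₂; module ≡-Reasoning) renaming (subst to ≡subst; subst₂ to ≡subst₂)
open import Relation.Nullary using (¬_; Dec; yes; no)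
open import Relation.Nullary.Decidable using (dec-true; dec-false; from-yes; from-no; map′; decidable-stable)
open Structure

module Classical (M : Structure) where

  Sat-stable : ∀ ρ A → ¬ ¬ Sat M ρ A → Sat M ρ A
  Sat-stable ρ ⊤' _ = tt
  Sat-stable ρ ⊥' h = h (λ x → x)
  Sat-stable ρ (t ≐ u) h = λ k → h (λ s → s k)
  Sat-stable ρ (t ≠ u) h = λ e → h (λ s → s e)
  Sat-stable ρ (A ∧' B) h =
    Sat-stable ρ A (λ k → h (λ ab → k (proj₁ ab))) , Sat-stable ρ B (λ k → h (λ ab → k (proj₂ ab)))
  Sat-stable ρ (A ∨' B) h = λ p → h (λ s → s p)
  Sat-stable ρ (A ⊓ B) _ = tt
  Sat-stable ρ (A ⊔ B) h = h (λ x → x)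
  Sat-stable ρ (∀' x A) h = λ d → Sat-stable _ A (λ k → h (λ f → k (f d)))
  Sat-stable ρ (∃' x A) h = λ p → h (λ s → s p)
  Sat-stable ρ (⊓x x A) _ = tt
  Sat-stable ρ (⊔x x A) h = h (λ x → x)

  Sat-neg⇒¬Sat : ∀ ρ A → Sat M ρ (neg A) → ¬ Sat M ρ A
  Sat-neg⇒¬Sat ρ ⊤' () _
  Sat-neg⇒¬Sat ρ ⊥' _ ()
  Sat-neg⇒¬Sat ρ (t ≐ u) n s = s n
  Sat-neg⇒¬Sat ρ (t ≠ u) nn n = nn n
  Sat-neg⇒¬Sat ρ (A ∧' B) h (a , b) = h ((λ na → Sat-neg⇒¬Sat ρ A na a) , (λ nb → Sat-neg⇒¬Sat ρ B nb b))
  Sat-neg⇒¬Sat ρ (A ∨' B) (na , nb) s = s (Sat-neg⇒¬Sat ρ A na , Sat-neg⇒¬Sat ρ B nb)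
  Sat-neg⇒¬Sat ρ (A ⊓ B) () _
  Sat-neg⇒¬Sat ρ (A ⊔ B) _ ()
  Sat-neg⇒¬Sat ρ (∀' x A) h f = h (λ d na → Sat-neg⇒¬Sat _ A na (f d))
  Sat-neg⇒¬Sat ρ (∃' x A) g h = h (λ d → Sat-neg⇒¬Sat _ A (g d))
  Sat-neg⇒¬Sat ρ (⊓x x A) () _
  Sat-neg⇒¬Sat ρ (⊔x x A) _ ()

  ¬Sat⇒Sat-neg : ∀ ρ A → ¬ Sat M ρ A → Sat M ρ (neg A)
  ¬Sat⇒Sat-neg ρ ⊤' n = n tt
  ¬Sat⇒Sat-neg ρ ⊥' n = tt
  ¬Sat⇒Sat-neg ρ (t ≐ u) n e = n (λ k → k e)
  ¬Sat⇒Sat-neg ρ (t ≠ u) n = n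
  ¬Sat⇒Sat-neg ρ (A ∧' B) n (p , q) = p (¬Sat⇒Sat-neg ρ A (λ a → q (¬Sat⇒Sat-neg ρ B (λ b → n (a , b)))))
  ¬Sat⇒Sat-neg ρ (A ∨' B) n =
    ¬Sat⇒Sat-neg ρ A (λ a → n (λ s → proj₁ s a)) , ¬Sat⇒Sat-neg ρ B (λ b → n (λ s → proj₂ s b))
  ¬Sat⇒Sat-neg ρ (A ⊓ B) n = n tt
  ¬Sat⇒Sat-neg ρ (A ⊔ B) n = tt
  ¬Sat⇒Sat-neg ρ (∀' x A) n g = n (λ d → Sat-stable _ A (λ na → g d (¬Sat⇒Sat-neg _ A na)))
  ¬Sat⇒Sat-neg ρ (∃' x A) n d = ¬Sat⇒Sat-neg _ A (λ a → n (λ f → f d a))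
  ¬Sat⇒Sat-neg ρ (⊓x x A) n = n tt
  ¬Sat⇒Sat-neg ρ (⊔x x A) n = tt

  ⇒-elim : ∀ ρ A B → Sat M ρ (A ⇒ B) → Sat M ρ A → Sat M ρ B
  ⇒-elim ρ A B h a = Sat-stable ρ B (λ nb → h ((λ na → Sat-neg⇒¬Sat ρ A na a) , nb))

  ⇒-intro : ∀ ρ A B → (Sat M ρ A → Sat M ρ B) → Sat M ρ (A ⇒ B)
  ⇒-intro ρ A B f (nna , nb) = nna (¬Sat⇒Sat-neg ρ A (λ a → nb (f a)))

  ¬Sat-neg⇒Sat : ∀ ρ A → ¬ Sat M ρ (neg A) → Sat M ρ A
  ¬Sat-neg⇒Sat ρ A n = Sat-stable ρ A (n ∘ ¬Sat⇒Sat-neg ρ A)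

  ∨-introʳ : ∀ ρ A B → Sat M ρ B → Sat M ρ (A ∨' B)
  ∨-introʳ ρ A B b (_ , nb) = nb b

  AllSat : (Var → D M) → List Formula → Set
  AllSat ρ [] = ⊤
  AllSat ρ (E ∷ Es) = Sat M ρ E × AllSat ρ Es

  conj-AllSat : ∀ ρ Es → Sat M ρ (conj Es) → AllSat ρ Es
  conj-AllSat ρ [] _ = tt
  conj-AllSat ρ (E ∷ []) s = s , tt
  conj-AllSat ρ (E ∷ E' ∷ Es) (s , r) = s , conj-AllSat ρ (E' ∷ Es) r

open Classical

T-∧₁ : ∀ {a b} → T (a ∧ b) → T a
T-∧₁ {true} _ = tt

T-∧₂ : ∀ {a b} → T (a ∧ b) → T b
T-∧₂ {true} t = t

data Kind : Set where
  ⊓-kind ⊔-kind : Kind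

is⊓ is⊔ : Kind → Bool
is⊓ ⊓-kind = true
is⊓ ⊔-kind = false
is⊔ k = not (is⊓ k)

isChoice : Kind → Formula → Bool
isChoice k (A ⊓ B) = is⊓ k
isChoice k (⊓x _ _) = is⊓ k
isChoice k (A ⊔ B) = is⊔ k
isChoice k (⊔x _ _) = is⊔ k
isChoice k _ = false

ChoiceFree : Kind → Formula → Bool
ChoiceFree k (A ∧' B) = ChoiceFree k A ∧ ChoiceFree k B
ChoiceFree k (A ∨' B) = ChoiceFree k A ∧ ChoiceFree k B
ChoiceFree k (∀' _ A) = ChoiceFree k A
ChoiceFree k (∃' _ A) = ChoiceFree k A
ChoiceFree k F = not (isChoice k F)

CtxChoiceFree : Kind → Ctx → Bool
CtxChoiceFree k ∙ = true
CtxChoiceFree k (C ∧ₗ B) = CtxChoiceFree k C ∧ ChoiceFree k B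
CtxChoiceFree k (A ∧ᵣ C) = ChoiceFree k A ∧ CtxChoiceFree k C
CtxChoiceFree k (C ∨ₗ B) = CtxChoiceFree k C ∧ ChoiceFree k B
CtxChoiceFree k (A ∨ᵣ C) = ChoiceFree k A ∧ CtxChoiceFree k C
CtxChoiceFree k (∀c _ C) = CtxChoiceFree k C
CtxChoiceFree k (∃c _ C) = CtxChoiceFree k C

AllChoiceFree : Kind → List Formula → Bool
AllChoiceFree k [] = true
AllChoiceFree k (E ∷ Es) = ChoiceFree k E ∧ AllChoiceFree k Es

plug-choice-not-free : ∀ k C P → T (isChoice k P) → ¬ T (ChoiceFree k (C ⟦ P ⟧))
plug-choice-not-free ⊓-kind ∙ (A ⊓ B) _ ()
plug-choice-not-free ⊓-kind ∙ (⊓x _ _) _ ()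
plug-choice-not-free ⊔-kind ∙ (A ⊔ B) _ ()
plug-choice-not-free ⊔-kind ∙ (⊔x _ _) _ ()
plug-choice-not-free k (C ∧ₗ B) P i t = plug-choice-not-free k C P i (T-∧₁ t)
plug-choice-not-free k (A ∧ᵣ C) P i t = plug-choice-not-free k C P i (T-∧₂ {ChoiceFree k A} t)
plug-choice-not-free k (C ∨ₗ B) P i t = plug-choice-not-free k C P i (T-∧₁ t)
plug-choice-not-free k (A ∨ᵣ C) P i t = plug-choice-not-free k C P i (T-∧₂ {ChoiceFree k A} t)
plug-choice-not-free k (∀c _ C) P i t = plug-choice-not-free k C P i t
plug-choice-not-free k (∃c _ C) P i t = plug-choice-not-free k C P i t

plug-choice⇒hole-at-top : ∀ k C P Q → T (isChoice k Q) → Q ≡ C ⟦ P ⟧ → C ≡ ∙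
plug-choice⇒hole-at-top k ∙ P Q _ _ = refl
plug-choice⇒hole-at-top k (C ∧ₗ B) P _ () refl
plug-choice⇒hole-at-top k (A ∧ᵣ C) P _ () refl
plug-choice⇒hole-at-top k (C ∨ₗ B) P _ () refl
plug-choice⇒hole-at-top k (A ∨ᵣ C) P _ () refl
plug-choice⇒hole-at-top k (∀c _ C) P _ () refl
plug-choice⇒hole-at-top k (∃c _ C) P _ () refl

∧-injective : ∀ {A B A' B'} → A ∧' B ≡ A' ∧' B' → A ≡ A' × B ≡ B'
∧-injective refl = refl , refl

∨-injective : ∀ {A B A' B'} → A ∨' B ≡ A' ∨' B' → A ≡ A' × B ≡ B'
∨-injective refl = refl , refl

∀-injective : ∀ {x y A B} → ∀' x A ≡ ∀' y B → x ≡ y × A ≡ B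
∀-injective refl = refl , refl

∃-injective : ∀ {x y A B} → ∃' x A ≡ ∃' y B → x ≡ y × A ≡ B
∃-injective refl = refl , refl

surface-choice-unique : ∀ k C C' P Q → T (isChoice k P) → T (isChoice k Q) → T (CtxChoiceFree k C) →
  C' ⟦ Q ⟧ ≡ C ⟦ P ⟧ → C' ≡ C × Q ≡ P
surface-choice-unique k C C' P Q iP iQ c eq = go C C' c eq
  where
  other-side : ∀ {C' A} → T (ChoiceFree k A) → A ≡ C' ⟦ Q ⟧ → ⊥
  other-side {C'} t e = plug-choice-not-free k C' Q iQ (≡subst (T ∘ ChoiceFree k) e t)

  go : ∀ C C' → T (CtxChoiceFree k C) → C' ⟦ Q ⟧ ≡ C ⟦ P ⟧ → C' ≡ C × Q ≡ P
  go ∙ C' _ eq with plug-choice⇒hole-at-top k C' Q P iP (sym eq)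
  ... | refl = refl , eq
  go C ∙ _ eq with plug-choice⇒hole-at-top k C P Q iQ eq
  ... | refl = refl , eq
  go (C ∧ₗ B) (C' ∧ₗ B') c eq with ∧-injective eq
  ... | e , refl with go C C' (T-∧₁ c) e
  ...   | refl , e' = refl , e'
  go (C ∧ₗ B) (A' ∧ᵣ C') c eq = ⊥-elim (other-side (T-∧₂ {CtxChoiceFree k C} c) (proj₂ (∧-injective (sym eq))))
  go (A ∧ᵣ C) (C' ∧ₗ B') c eq = ⊥-elim (other-side (T-∧₁ c) (proj₁ (∧-injective (sym eq))))
  go (A ∧ᵣ C) (A' ∧ᵣ C') c eq with ∧-injective eq
  ... | refl , e with go C C' (T-∧₂ {ChoiceFree k A} c) e
  ...   | refl , e' = refl , e'
  go (C ∨ₗ B) (C' ∨ₗ B') c eq with ∨-injective eq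
  ... | e , refl with go C C' (T-∧₁ c) e
  ...   | refl , e' = refl , e'
  go (C ∨ₗ B) (A' ∨ᵣ C') c eq = ⊥-elim (other-side (T-∧₂ {CtxChoiceFree k C} c) (proj₂ (∨-injective (sym eq))))
  go (A ∨ᵣ C) (C' ∨ₗ B') c eq = ⊥-elim (other-side (T-∧₁ c) (proj₁ (∨-injective (sym eq))))
  go (A ∨ᵣ C) (A' ∨ᵣ C') c eq with ∨-injective eq
  ... | refl , e with go C C' (T-∧₂ {ChoiceFree k A} c) e
  ...   | refl , e' = refl , e'
  go (∀c x C) (∀c x' C') c eq with ∀-injective eq
  ... | refl , e with go C C' c e
  ...   | refl , e' = refl , e'
  go (∃c x C) (∃c x' C') c eq with ∃-injective eq
  ... | refl , e with go C C' c e
  ...   | refl , e' = refl , e'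
  go (_ ∧ₗ _) (_ ∨ₗ _) _ ()
  go (_ ∧ₗ _) (_ ∨ᵣ _) _ ()
  go (_ ∧ₗ _) (∀c _ _) _ ()
  go (_ ∧ₗ _) (∃c _ _) _ ()
  go (_ ∧ᵣ _) (_ ∨ₗ _) _ ()
  go (_ ∧ᵣ _) (_ ∨ᵣ _) _ ()
  go (_ ∧ᵣ _) (∀c _ _) _ ()
  go (_ ∧ᵣ _) (∃c _ _) _ ()
  go (_ ∨ₗ _) (_ ∧ₗ _) _ ()
  go (_ ∨ₗ _) (_ ∧ᵣ _) _ ()
  go (_ ∨ₗ _) (∀c _ _) _ ()
  go (_ ∨ₗ _) (∃c _ _) _ ()
  go (_ ∨ᵣ _) (_ ∧ₗ _) _ ()
  go (_ ∨ᵣ _) (_ ∧ᵣ _) _ ()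
  go (_ ∨ᵣ _) (∀c _ _) _ ()
  go (_ ∨ᵣ _) (∃c _ _) _ ()
  go (∀c _ _) (_ ∧ₗ _) _ ()
  go (∀c _ _) (_ ∧ᵣ _) _ ()
  go (∀c _ _) (_ ∨ₗ _) _ ()
  go (∀c _ _) (_ ∨ᵣ _) _ ()
  go (∀c _ _) (∃c _ _) _ ()
  go (∃c _ _) (_ ∧ₗ _) _ ()
  go (∃c _ _) (_ ∧ᵣ _) _ ()
  go (∃c _ _) (_ ∨ₗ _) _ ()
  go (∃c _ _) (_ ∨ᵣ _) _ ()
  go (∃c _ _) (∀c _ _) _ ()

choice-free-middle : ∀ k G E K → T (AllChoiceFree k (G ++ E ∷ K)) → T (ChoiceFree k E)
choice-free-middle k [] E K t = T-∧₁ t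
choice-free-middle k (g ∷ G) E K t = choice-free-middle k G E K (T-∧₂ {ChoiceFree k g} t)

antecedent-choice-unique : ∀ k G K G₀ K₀ E E₀ → T (AllChoiceFree k G₀) → T (AllChoiceFree k K₀) →
  ¬ T (ChoiceFree k E) → G ++ E ∷ K ≡ G₀ ++ E₀ ∷ K₀ → G ≡ G₀ × E ≡ E₀ × K ≡ K₀
antecedent-choice-unique k [] K [] K₀ E E₀ _ _ _ refl = refl , refl , refl
antecedent-choice-unique k [] K (g ∷ G₀) K₀ E E₀ a _ n eq =
  ⊥-elim (n (≡subst (T ∘ ChoiceFree k) (sym (proj₁ (∷-injective eq))) (T-∧₁ a)))
antecedent-choice-unique k (g ∷ G) K [] K₀ E E₀ _ b n eq =
  ⊥-elim (n (choice-free-middle k G E K (≡subst (T ∘ AllChoiceFree k) (sym (proj₂ (∷-injective eq))) b)))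
antecedent-choice-unique k (g ∷ G) K (g₀ ∷ G₀) K₀ E E₀ a b n eq with ∷-injective eq
... | refl , eq' with antecedent-choice-unique k G K G₀ K₀ E E₀ (T-∧₂ {ChoiceFree k g₀} a) b n eq'
...   | refl , e , f = refl , e , f

no-antecedent-choice : ∀ k Γ G K C P → T (isChoice k P) → T (AllChoiceFree k Γ) → Γ ≢ G ++ C ⟦ P ⟧ ∷ K
no-antecedent-choice k Γ G K C P i a refl = plug-choice-not-free k C P i (choice-free-middle k G _ K a)

no-succedent-choice : ∀ k F C P → T (isChoice k P) → T (ChoiceFree k F) → F ≢ C ⟦ P ⟧
no-succedent-choice k F C P i t refl = plug-choice-not-free k C P i t

infix 3 _⊨ᵉ_
_⊨ᵉ_ : List Formula → Formula → Set₁
Γ ⊨ᵉ F = ∀ M ρ → AllSat M ρ (map ‖_‖ Γ) → Sat M ρ ‖ F ‖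

stable-by : ∀ Γ F → Γ ⊨ᵉ F → Stable (Γ ∘- F)
stable-by [] F f M ρ = f M ρ tt
stable-by (E ∷ Γ) F f M ρ =
  ⇒-intro M ρ (conj (map ‖_‖ (E ∷ Γ))) ‖ F ‖ (λ c → f M ρ (conj-AllSat M ρ (map ‖_‖ (E ∷ Γ)) c))

Sat-middle : ∀ M ρ G E K → AllSat M ρ (map ‖_‖ (G ++ E ∷ K)) → Sat M ρ ‖ E ‖
Sat-middle M ρ [] E K (s , _) = s
Sat-middle M ρ (_ ∷ G) E K (_ , s) = Sat-middle M ρ G E K s

Sat-last : ∀ M ρ G E → AllSat M ρ (map ‖_‖ (G ++ E ∷ [])) → Sat M ρ ‖ E ‖
Sat-last M ρ G E = Sat-middle M ρ G E []

wait-elementary : ∀ Γ F → T (AllChoiceFree ⊔-kind Γ) → T (ChoiceFree ⊓-kind F) → Γ ⊨ᵉ F → CL12⊢ (Γ ∘- F)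
wait-elementary Γ F a f st = wait [] (λ ()) (stable-by Γ F st)
  ( (λ C A B eq → ⊥-elim (no-succedent-choice ⊓-kind F C (A ⊓ B) tt f eq))
  , (λ G K C A B eq → ⊥-elim (no-antecedent-choice ⊔-kind Γ G K C (A ⊔ B) tt a eq))
  , (λ C x H eq → ⊥-elim (no-succedent-choice ⊓-kind F C (⊓x x H) tt f eq))
  , (λ G K C x H eq → ⊥-elim (no-antecedent-choice ⊔-kind Γ G K C (⊔x x H) tt a eq)) )

wait-⊓x : ∀ Γ C x H y → T (CtxChoiceFree ⊓-kind C) → T (AllChoiceFree ⊔-kind Γ) →
  ¬ OccursIn y (Γ ∘- C ⟦ ⊓x x H ⟧) → Γ ⊨ᵉ C ⟦ ⊓x x H ⟧ →
  CL12⊢ (Γ ∘- C ⟦ subst x (var y) H ⟧) → CL12⊢ (Γ ∘- C ⟦ ⊓x x H ⟧)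
wait-⊓x Γ C x H y c a fr st d = wait (_ ∷ []) (λ { (here refl) → d }) (stable-by Γ _ st)
  ( (λ C' H₀ H₁ eq → ⊥-elim (⊓≢⊓x (proj₂ (unique C' (H₀ ⊓ H₁) tt eq))))
  , (λ G K C' H₀ H₁ eq → ⊥-elim (no-antecedent-choice ⊔-kind Γ G K C' (H₀ ⊔ H₁) tt a eq))
  , (λ C' x' H' eq → premise (unique C' (⊓x x' H') tt eq))
  , (λ G K C' x' H' eq → ⊥-elim (no-antecedent-choice ⊔-kind Γ G K C' (⊔x x' H') tt a eq)) )
  where
  ⊓≢⊓x : ∀ {A B} → A ⊓ B ≢ ⊓x x H
  ⊓≢⊓x ()
  unique : ∀ C' Q → T (isChoice ⊓-kind Q) → C ⟦ ⊓x x H ⟧ ≡ C' ⟦ Q ⟧ → C' ≡ C × Q ≡ ⊓x x H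
  unique C' Q i eq = surface-choice-unique ⊓-kind C C' (⊓x x H) Q tt i c (sym eq)
  premise : ∀ {C' x' H'} → C' ≡ C × ⊓x x' H' ≡ ⊓x x H →
    Σ Var λ y' → ¬ OccursIn y' (Γ ∘- C ⟦ ⊓x x H ⟧) × ((Γ ∘- C' ⟦ subst x' (var y') H' ⟧) ∈ (_ ∷ []))
  premise (refl , refl) = y , fr , here refl

wait-⊓ : ∀ Γ C H₀ H₁ → T (CtxChoiceFree ⊓-kind C) → T (AllChoiceFree ⊔-kind Γ) → Γ ⊨ᵉ C ⟦ H₀ ⊓ H₁ ⟧ →
  CL12⊢ (Γ ∘- C ⟦ H₀ ⟧) → CL12⊢ (Γ ∘- C ⟦ H₁ ⟧) → CL12⊢ (Γ ∘- C ⟦ H₀ ⊓ H₁ ⟧)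
wait-⊓ Γ C H₀ H₁ c a st d₀ d₁ =
  wait (_ ∷ _ ∷ []) (λ { (here refl) → d₀ ; (there (here refl)) → d₁ }) (stable-by Γ _ st)
  ( (λ C' A B eq → premises (unique C' (A ⊓ B) tt eq))
  , (λ G K C' A B eq → ⊥-elim (no-antecedent-choice ⊔-kind Γ G K C' (A ⊔ B) tt a eq))
  , (λ C' x H eq → ⊥-elim (⊓x≢⊓ (proj₂ (unique C' (⊓x x H) tt eq))))
  , (λ G K C' x H eq → ⊥-elim (no-antecedent-choice ⊔-kind Γ G K C' (⊔x x H) tt a eq)) )
  where
  ⊓x≢⊓ : ∀ {x H} → ⊓x x H ≢ H₀ ⊓ H₁
  ⊓x≢⊓ ()
  unique : ∀ C' Q → T (isChoice ⊓-kind Q) → C ⟦ H₀ ⊓ H₁ ⟧ ≡ C' ⟦ Q ⟧ → C' ≡ C × Q ≡ H₀ ⊓ H₁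
  unique C' Q i eq = surface-choice-unique ⊓-kind C C' (H₀ ⊓ H₁) Q tt i c (sym eq)
  premises : ∀ {C' A B} → C' ≡ C × A ⊓ B ≡ H₀ ⊓ H₁ →
    ((Γ ∘- C' ⟦ A ⟧) ∈ (_ ∷ _ ∷ [])) × ((Γ ∘- C' ⟦ B ⟧) ∈ ((Γ ∘- C ⟦ H₀ ⟧) ∷ (Γ ∘- C ⟦ H₁ ⟧) ∷ []))
  premises (refl , refl) = here refl , there (here refl)

wait-⊔x : ∀ G K C x H F y → T (CtxChoiceFree ⊔-kind C) → T (AllChoiceFree ⊔-kind G) →
  T (AllChoiceFree ⊔-kind K) → T (ChoiceFree ⊓-kind F) →
  ¬ OccursIn y (G ++ C ⟦ ⊔x x H ⟧ ∷ K ∘- F) → G ++ C ⟦ ⊔x x H ⟧ ∷ K ⊨ᵉ F →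
  CL12⊢ (G ++ C ⟦ subst x (var y) H ⟧ ∷ K ∘- F) → CL12⊢ (G ++ C ⟦ ⊔x x H ⟧ ∷ K ∘- F)
wait-⊔x G K C x H F y c g k f fr st d = wait (_ ∷ []) (λ { (here refl) → d }) (stable-by _ F st)
  ( (λ C' H₀ H₁ eq → ⊥-elim (no-succedent-choice ⊓-kind F C' (H₀ ⊓ H₁) tt f eq))
  , (λ G' K' C' A B eq → ⊥-elim (⊔≢⊔x (proj₂ (proj₂ (proj₂ (unique G' K' C' (A ⊔ B) tt eq))))))
  , (λ C' x' H' eq → ⊥-elim (no-succedent-choice ⊓-kind F C' (⊓x x' H') tt f eq))
  , (λ G' K' C' x' H' eq → premise (unique G' K' C' (⊔x x' H') tt eq)) )
  where
  ⊔≢⊔x : ∀ {A B} → A ⊔ B ≢ ⊔x x H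
  ⊔≢⊔x ()
  unique : ∀ G' K' C' Q → T (isChoice ⊔-kind Q) → G ++ C ⟦ ⊔x x H ⟧ ∷ K ≡ G' ++ C' ⟦ Q ⟧ ∷ K' →
    G' ≡ G × K' ≡ K × C' ≡ C × Q ≡ ⊔x x H
  unique G' K' C' Q i eq with antecedent-choice-unique ⊔-kind G' K' G K _ _ g k
                                (plug-choice-not-free ⊔-kind C' Q i) (sym eq)
  ... | eG , e , eK = eG , eK , surface-choice-unique ⊔-kind C C' (⊔x x H) Q tt i c e
  premise : ∀ {G' K' C' x' H'} → G' ≡ G × K' ≡ K × C' ≡ C × ⊔x x' H' ≡ ⊔x x H →
    Σ Var λ y' → ¬ OccursIn y' (G ++ C ⟦ ⊔x x H ⟧ ∷ K ∘- F) ×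
      ((G' ++ C' ⟦ subst x' (var y') H' ⟧ ∷ K' ∘- F) ∈ (_ ∷ []))
  premise (refl , refl , refl , refl) = y , fr , here refl

wait-⊔ : ∀ G K C H₀ H₁ F → T (CtxChoiceFree ⊔-kind C) → T (AllChoiceFree ⊔-kind G) →
  T (AllChoiceFree ⊔-kind K) → T (ChoiceFree ⊓-kind F) → G ++ C ⟦ H₀ ⊔ H₁ ⟧ ∷ K ⊨ᵉ F →
  CL12⊢ (G ++ C ⟦ H₀ ⟧ ∷ K ∘- F) → CL12⊢ (G ++ C ⟦ H₁ ⟧ ∷ K ∘- F) → CL12⊢ (G ++ C ⟦ H₀ ⊔ H₁ ⟧ ∷ K ∘- F)
wait-⊔ G K C H₀ H₁ F c g k f st d₀ d₁ =
  wait (_ ∷ _ ∷ []) (λ { (here refl) → d₀ ; (there (here refl)) → d₁ }) (stable-by _ F st)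
  ( (λ C' A B eq → ⊥-elim (no-succedent-choice ⊓-kind F C' (A ⊓ B) tt f eq))
  , (λ G' K' C' A B eq → premises (unique G' K' C' (A ⊔ B) tt eq))
  , (λ C' x' H' eq → ⊥-elim (no-succedent-choice ⊓-kind F C' (⊓x x' H') tt f eq))
  , (λ G' K' C' x' H' eq → ⊥-elim (⊔x≢⊔ (proj₂ (proj₂ (proj₂ (unique G' K' C' (⊔x x' H') tt eq)))))) )
  where
  ⊔x≢⊔ : ∀ {x H} → ⊔x x H ≢ H₀ ⊔ H₁
  ⊔x≢⊔ ()
  unique : ∀ G' K' C' Q → T (isChoice ⊔-kind Q) → G ++ C ⟦ H₀ ⊔ H₁ ⟧ ∷ K ≡ G' ++ C' ⟦ Q ⟧ ∷ K' →
    G' ≡ G × K' ≡ K × C' ≡ C × Q ≡ H₀ ⊔ H₁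
  unique G' K' C' Q i eq with antecedent-choice-unique ⊔-kind G' K' G K _ _ g k
                                (plug-choice-not-free ⊔-kind C' Q i) (sym eq)
  ... | eG , e , eK = eG , eK , surface-choice-unique ⊔-kind C C' (H₀ ⊔ H₁) Q tt i c e
  premises : ∀ {G' K' C' A B} → G' ≡ G × K' ≡ K × C' ≡ C × A ⊔ B ≡ H₀ ⊔ H₁ →
    ((G' ++ C' ⟦ A ⟧ ∷ K' ∘- F) ∈ (_ ∷ _ ∷ [])) ×
    ((G' ++ C' ⟦ B ⟧ ∷ K' ∘- F) ∈ ((G ++ C ⟦ H₀ ⟧ ∷ K ∘- F) ∷ (G ++ C ⟦ H₁ ⟧ ∷ K ∘- F) ∷ []))
  premises (refl , refl , refl , refl) = here refl , there (here refl)

eqb-refl : ∀ x → eqb x x ≡ true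
eqb-refl x = dec-true (x ≟ x) refl

eqb-≢ : ∀ {x y} → x ≢ y → eqb x y ≡ false
eqb-≢ {x} {y} = dec-false (x ≟ y)

mentions : (Formula → List Var) → Var → Sequent → Bool
mentions f y X = any (λ E → any (eqb y) (f E)) (seqFormulas X)

mentions-complete : ∀ f y X {E} → E ∈ seqFormulas X → y ∈ f E → T (mentions f y X)
mentions-complete f y X e m =
  any⁺ _ (Any.map (λ { refl → any⁺ _ (Any.map (λ { refl → ≡subst T (sym (eqb-refl y)) tt }) m) }) e)

T-not⇒¬T : ∀ {b} → T (not b) → ¬ T b
T-not⇒¬T {true} ()

not-mentioned⇒fresh : ∀ y X → T (not (mentions vars y X)) → ¬ OccursIn y X
not-mentioned⇒fresh y X t (E , e , m) = T-not⇒¬T t (mentions-complete vars y X e m)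

not-mentioned⇒admissible : ∀ y X → T (not (mentions bound y X)) → Admissible (var y) X
not-mentioned⇒admissible y X t = inj₂ (y , refl , λ { (E , e , m) → T-not⇒¬T t (mentions-complete bound y X e m) })

seqVars : Sequent → List Var
seqVars X = concatMap vars (seqFormulas X)

newVar : Sequent → Var
newVar X = suc (max 0 (seqVars X))

occurs⇒<newVar : ∀ {y} X → OccursIn y X → y < newVar X
occurs⇒<newVar X (E , e , m) = s≤s (All.lookup (xs≤max 0 (seqVars X)) (∈-concatMap⁺ vars (Any.map (λ { refl → m }) e)))

newVar-fresh : ∀ X → ¬ OccursIn (newVar X) X
newVar-fresh X o = n≮n _ (occurs⇒<newVar X o)

module _ {A : Set} where

  infix 4 _≈_
  _≈_ : A → A → Set
  a ≈ b = ¬ ¬ (a ≡ b)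

  ≈-refl : ∀ {a} → a ≈ a
  ≈-refl n = n refl

  ≈-sym : ∀ {a b} → a ≈ b → b ≈ a
  ≈-sym p n = p (λ e → n (sym e))

  ≈-trans : ∀ {a b c} → a ≈ b → b ≈ c → a ≈ c
  ≈-trans p q n = p (λ e₁ → q (λ e₂ → n (trans e₁ e₂)))

  ≈-cong : ∀ {a b} (f : A → A) → a ≈ b → f a ≈ f b
  ≈-cong f p n = p (λ e → n (cong f e))

  ≈-cong₂ : ∀ {a b c d} (f : A → A → A) → a ≈ b → c ≈ d → f a c ≈ f b d
  ≈-cong₂ f p q n = p (λ e₁ → q (λ e₂ → n (cong₂ f e₁ e₂)))

  ≡⇒≈ : ∀ {a b} → a ≡ b → a ≈ b
  ≡⇒≈ e n = n e

substT-fresh : ∀ x s t → ¬ x ∈ freeT t → substT x s t ≡ t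
substT-fresh x s (var y) n rewrite eqb-≢ {x} {y} (n ∘ here) = refl
substT-fresh x s ‘0’ n = refl
substT-fresh x s (t ′) n = cong _′ (substT-fresh x s t n)
substT-fresh x s (t ⊕ u) n = cong₂ _⊕_ (substT-fresh x s t (n ∘ ∈-++⁺ˡ)) (substT-fresh x s u (n ∘ ∈-++⁺ʳ (freeT t)))
substT-fresh x s (t ⊗ u) n = cong₂ _⊗_ (substT-fresh x s t (n ∘ ∈-++⁺ˡ)) (substT-fresh x s u (n ∘ ∈-++⁺ʳ (freeT t)))

data BinOp : Set where
  plus times : BinOp

apply : BinOp → Term → Term → Term
apply plus = _⊕_
apply times = _⊗_

applyᴰ : (M : Structure) → BinOp → Structure.D M → Structure.D M → Structure.D M
applyᴰ M plus = Structure.add M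
applyᴰ M times = Structure.mul M

evalT-apply : ∀ M ρ o a b → evalT M ρ (apply o a b) ≡ applyᴰ M o (evalT M ρ a) (evalT M ρ b)
evalT-apply M ρ plus a b = refl
evalT-apply M ρ times a b = refl

substT-apply : ∀ x s o a b → substT x s (apply o a b) ≡ apply o (substT x s a) (substT x s b)
substT-apply x s plus a b = refl
substT-apply x s times a b = refl

Successor : Formula
Successor = ⊓x 0 (⊔x 1 (var 1 ≐ (var 0 ′)))

Binary : BinOp → Formula
Binary o = ⊓x 0 (⊓x 1 (⊔x 2 (var 2 ≐ apply o (var 0) (var 1))))

Resources : List Formula
Resources = Successor ∷ Binary plus ∷ Binary times ∷ []

Equation : Formula → Set
Equation E = Σ Term λ a → Σ Term λ b → E ≡ (a ≐ b)

Binders≤ : ℕ → Formula → Set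
Binders≤ n E = ∀ {v} → v ∈ bound E → v ≤ n

resource-binders≤2 : All (Binders≤ 2) Resources
resource-binders≤2 = b₁ ∷ b₂ plus ∷ b₂ times ∷ []
  where
  b₁ : Binders≤ 2 Successor
  b₁ (here refl) = z≤n
  b₁ (there (here refl)) = s≤s z≤n
  b₂ : ∀ o → Binders≤ 2 (Binary o)
  b₂ o (here refl) = z≤n
  b₂ o (there (here refl)) = s≤s z≤n
  b₂ o (there (there (here refl))) = s≤s (s≤s z≤n)

resources-and-equations-binders≤ : ∀ {n} Δ → 2 ≤ n → All Equation Δ → All (Binders≤ n) (Resources ++ Δ)
resources-and-equations-binders≤ Δ 2≤n eqs =
  ++⁺ (All.map (λ b {_} m → ≤-trans (b m) 2≤n) resource-binders≤2) (All.map equation-binders eqs)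
  where
  equation-binders : ∀ {n E} → Equation E → Binders≤ n E
  equation-binders (_ , _ , refl) {_} ()

binders≤⇒unbound : ∀ X {n w} → All (Binders≤ n) (seqFormulas X) → n < w → ¬ BoundIn w X
binders≤⇒unbound X bs n<w (E , e , m) = <⇒≱ n<w (All.lookup bs e m)

equations-choice-free : ∀ {Δ} → All Equation Δ → T (AllChoiceFree ⊔-kind Δ)
equations-choice-free [] = tt
equations-choice-free ((_ , _ , refl) ∷ eqs) = equations-choice-free eqs

equations-elementary : ∀ {M ρ Δ} → All Equation Δ → AllSat M ρ (map ‖_‖ Δ) → AllSat M ρ Δ
equations-elementary [] _ = tt
equations-elementary ((_ , _ , refl) ∷ eqs) (s , ss) = s , equations-elementary eqs ss

AllSat-++⁻ : ∀ M ρ A B → AllSat M ρ (A ++ B) → AllSat M ρ A × AllSat M ρ B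
AllSat-++⁻ M ρ [] B s = tt , s
AllSat-++⁻ M ρ (E ∷ A) B (e , s) = let a , b = AllSat-++⁻ M ρ A B s in (e , a) , b

Replicable : Formula → Set₁
Replicable R = ∀ {Δ F} → CL12⊢ ((Resources ++ Δ) ++ R ∷ [] ∘- F) → CL12⊢ (Resources ++ Δ ∘- F)

replicate-successor : Replicable Successor
replicate-successor {Δ} = replicate {G = []} {K = Binary plus ∷ Binary times ∷ Δ} Successor

replicate-addition : Replicable (Binary plus)
replicate-addition {Δ} = replicate {G = Successor ∷ []} {K = Binary times ∷ Δ} (Binary plus)

replicate-multiplication : Replicable (Binary times)
replicate-multiplication {Δ} = replicate {G = Successor ∷ Binary plus ∷ []} {K = Δ} (Binary times)

recontext : ∀ {Γ Γ' F} → Γ ≡ Γ' → CL12⊢ (Γ ∘- F) → CL12⊢ (Γ' ∘- F)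
recontext {F = F} = ≡subst (λ Γ → CL12⊢ (Γ ∘- F))

-- Variables up to z ⊔ 2 are binders of the goal or of the resources.  Query
-- arguments are kept above them: this makes them admissible for the choose
-- rules and immune to substitution for the resources' bound variables.
module Evaluation (z : Var) (goal : Term) where

  reserved : ℕ
  reserved = z ⊔ℕ 2

  2≤reserved : 2 ≤ reserved
  2≤reserved = m≤n⊔m z 2

  Goal : Formula
  Goal = ⊔x z (var z ≐ goal)

  Operand : Term → Set
  Operand b = b ≡ ‘0’ ⊎ Σ Var λ w → b ≡ var w × reserved < w

  operand-avoids : ∀ {x b} → x ≤ 2 → Operand b → ¬ x ∈ freeT b
  operand-avoids x≤2 (inj₁ refl) ()
  operand-avoids x≤2 (inj₂ (w , refl , lt)) (here refl) = <⇒≱ lt (≤-trans x≤2 2≤reserved)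

  operand-admissible : ∀ X {b} → All (Binders≤ reserved) (seqFormulas X) → Operand b → Admissible b X
  operand-admissible X bs (inj₁ e) = inj₁ e
  operand-admissible X bs (inj₂ (w , e , lt)) = inj₂ (w , e , binders≤⇒unbound X bs lt)

  query-binders : ∀ Δ E → All Equation Δ → Binders≤ 2 E →
    All (Binders≤ reserved) (seqFormulas ((Resources ++ Δ) ++ E ∷ [] ∘- Goal))
  query-binders Δ E eqs bE =
    (λ { (here refl) → m≤m⊔n z 2 })
    ∷ ++⁺ (resources-and-equations-binders≤ Δ 2≤reserved eqs) ((λ {_} m → ≤-trans (bE m) 2≤reserved) ∷ [])

  newVar-operand : ∀ Γ → Binary plus ∈ Γ → Operand (var (newVar (Γ ∘- Goal)))
  newVar-operand Γ p = inj₂ (_ , refl , ⊔-lub (occurs⇒<newVar X (Goal , here refl , ∈-++⁺ʳ (free Goal) (here refl)))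
                                               (occurs⇒<newVar X (Binary plus , there p , there (there (here refl)))))
    where X = Γ ∘- Goal

  Continuation : List Formula → Term → Set₁
  Continuation Δ r = (y : Var) → Operand (var y) → CL12⊢ ((Resources ++ Δ) ++ (var y ≐ r) ∷ [] ∘- Goal)

  query-successor : ∀ Δ b → All Equation Δ → Operand b → Continuation Δ (b ′) → CL12⊢ (Resources ++ Δ ∘- Goal)
  query-successor Δ b eqs ob k =
    replicate-successor
      (⊓x-choose {G = Resources ++ Δ} {K = []} ∙ 0 (⊔x 1 (var 1 ≐ (var 0 ′))) b
        (operand-admissible _ (query-binders Δ _ eqs λ { (here refl) → s≤s z≤n }) ob)
        (wait-⊔x (Resources ++ Δ) [] ∙ 1 (var 1 ≐ (b ′)) Goal y tt (equations-choice-free eqs) tt tt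
          (newVar-fresh X) (λ M ρ s → ⊥-elim (Sat-last M ρ (Resources ++ Δ) _ s))
          (≡subst (λ u → CL12⊢ ((Resources ++ Δ) ++ (var y ≐ (u ′)) ∷ [] ∘- Goal))
            (sym (substT-fresh 1 (var y) b (operand-avoids (s≤s z≤n) ob)))
            (k y (newVar-operand ((Resources ++ Δ) ++ _ ∷ []) (there (here refl)))))))
    where
    X = (Resources ++ Δ) ++ ⊔x 1 (var 1 ≐ (b ′)) ∷ [] ∘- Goal
    y = newVar X

  query-binary : ∀ o → Replicable (Binary o) → ∀ Δ b c → All Equation Δ → Operand b → Operand c →
    Continuation Δ (apply o b c) → CL12⊢ (Resources ++ Δ ∘- Goal)
  query-binary o dup Δ b c eqs ob oc k =
    dup (⊓x-choose {G = Resources ++ Δ} {K = []} ∙ 0 (⊓x 1 (⊔x 2 (var 2 ≐ apply o (var 0) (var 1)))) b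
          (operand-admissible _ (query-binders Δ _ eqs λ { (here refl) → s≤s z≤n ; (there (here refl)) → ≤-refl }) ob)
        (⊓x-choose {G = Resources ++ Δ} {K = []} ∙ 1 (⊔x 2 (var 2 ≐ substT 0 b (apply o (var 0) (var 1)))) c
          (operand-admissible _ (query-binders Δ _ eqs λ { (here refl) → ≤-refl }) oc)
        (≡subst (λ u → CL12⊢ ((Resources ++ Δ) ++ ⊔x 2 (var 2 ≐ u) ∷ [] ∘- Goal)) (sym instantiate)
        (wait-⊔x (Resources ++ Δ) [] ∙ 2 (var 2 ≐ apply o b c) Goal y tt (equations-choice-free eqs) tt tt
          (newVar-fresh X) (λ M ρ s → ⊥-elim (Sat-last M ρ (Resources ++ Δ) _ s))
          (≡subst (λ u → CL12⊢ ((Resources ++ Δ) ++ (var y ≐ u) ∷ [] ∘- Goal)) (sym untouched)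
            (k y (newVar-operand ((Resources ++ Δ) ++ _ ∷ []) (there (here refl)))))))))
    where
    X = (Resources ++ Δ) ++ ⊔x 2 (var 2 ≐ apply o b c) ∷ [] ∘- Goal
    y = newVar X
    instantiate : substT 1 c (substT 0 b (apply o (var 0) (var 1))) ≡ apply o b c
    instantiate = begin
      substT 1 c (substT 0 b (apply o (var 0) (var 1)))  ≡⟨ cong (substT 1 c) (substT-apply 0 b o (var 0) (var 1)) ⟩
      substT 1 c (apply o b (var 1))                      ≡⟨ substT-apply 1 c o b (var 1) ⟩
      apply o (substT 1 c b) c                            ≡⟨ cong (λ u → apply o u c) (substT-fresh 1 c b (operand-avoids (s≤s z≤n) ob)) ⟩
      apply o b c                                         ∎
      where open ≡-Reasoning
    untouched : substT 2 (var y) (apply o b c) ≡ apply o b c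
    untouched = trans (substT-apply 2 (var y) o b c)
      (cong₂ (apply o) (substT-fresh 2 (var y) b (operand-avoids ≤-refl ob)) (substT-fresh 2 (var y) c (operand-avoids ≤-refl oc)))

  regroup : ∀ Δ Γ E → Resources ++ (Δ ++ (Γ ++ E)) ≡ (Resources ++ (Δ ++ Γ)) ++ E
  regroup Δ Γ E = trans (cong (Resources ++_) (sym (++-assoc Δ Γ E))) (sym (++-assoc Resources (Δ ++ Γ) E))

  Evaluates : List Formula → Term → Term → Set₁
  Evaluates Δ b t = ∀ M ρ → AllSat M ρ Δ → evalT M ρ b ≈ evalT M ρ t

  Evaluable : Term → Set₁
  Evaluable t = ∀ Δ → All Equation Δ →
    (∀ b → Operand b → ∀ Δ' → All Equation Δ' → Evaluates Δ' b t → CL12⊢ (Resources ++ (Δ ++ Δ') ∘- Goal)) →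
    CL12⊢ (Resources ++ Δ ∘- Goal)

  Unreserved : Term → Set
  Unreserved t = ∀ {w} → w ∈ freeT t → reserved < w

  -- Evaluate t bottom-up; every intermediate value is named by a fresh
  -- variable returned by a resource, and the equations recording these
  -- answers accumulate in the antecedent.
  evaluate : ∀ t → Unreserved t → Evaluable t
  evaluate-binary : ∀ o → Replicable (Binary o) → ∀ s u → Unreserved s → Unreserved u → Evaluable (apply o s u)
  evaluate ‘0’ _ Δ eqs k =
    recontext (cong (Resources ++_) (++-identityʳ Δ)) (k ‘0’ (inj₁ refl) [] [] (λ _ _ _ → ≈-refl))
  evaluate (var w) ur Δ eqs k =
    recontext (cong (Resources ++_) (++-identityʳ Δ)) (k (var w) (inj₂ (w , refl , ur (here refl))) [] [] (λ _ _ _ → ≈-refl))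
  evaluate (s ′) ur Δ eqs k =
    evaluate s ur Δ eqs λ b ob Δs eqs-s es →
    query-successor (Δ ++ Δs) b (++⁺ eqs eqs-s) ob λ y oy →
    recontext (regroup Δ Δs _) (k (var y) oy (Δs ++ _ ∷ []) (++⁺ eqs-s ((_ , _ , refl) ∷ []))
      λ M ρ sat → let ss , (e , _) = AllSat-++⁻ M ρ Δs _ sat in ≈-trans e (≈-cong (Structure.suc' M) (es M ρ ss)))
  evaluate (s ⊕ u) ur = evaluate-binary plus replicate-addition s u (ur ∘ ∈-++⁺ˡ) (ur ∘ ∈-++⁺ʳ (freeT s))
  evaluate (s ⊗ u) ur = evaluate-binary times replicate-multiplication s u (ur ∘ ∈-++⁺ˡ) (ur ∘ ∈-++⁺ʳ (freeT s))

  evaluate-binary o dup s u ur-s ur-u Δ eqs k =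
    evaluate s ur-s Δ eqs λ b ob Δs eqs-s es →
    evaluate u ur-u (Δ ++ Δs) (++⁺ eqs eqs-s) λ c oc Δu eqs-u eu →
    query-binary o dup ((Δ ++ Δs) ++ Δu) b c (++⁺ (++⁺ eqs eqs-s) eqs-u) ob oc λ y oy →
    recontext (trans (cong (Resources ++_) (sym (++-assoc Δ Δs _))) (regroup (Δ ++ Δs) Δu _))
      (k (var y) oy (Δs ++ Δu ++ _ ∷ []) (++⁺ eqs-s (++⁺ eqs-u ((_ , _ , refl) ∷ [])))
        λ M ρ sat →
          let ss , rest = AllSat-++⁻ M ρ Δs _ sat
              su , (e , _) = AllSat-++⁻ M ρ Δu _ rest
          in ≈-trans e (≈-trans (≡⇒≈ (evalT-apply M ρ o b c))
               (≈-trans (≈-cong₂ (applyᴰ M o) (es M ρ ss) (eu M ρ su)) (≡⇒≈ (sym (evalT-apply M ρ o s u))))))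

  solve-goal : Unreserved goal → CL12⊢ (Resources ∘- Goal)
  solve-goal ur = evaluate goal ur [] [] λ b ob Δ eqs es →
    ⊔x-choose {G = Resources ++ Δ} ∙ z (var z ≐ goal) b
      (operand-admissible _ ((λ ()) ∷ resources-and-equations-binders≤ Δ 2≤reserved eqs) ob)
      (≡subst (λ F → CL12⊢ (Resources ++ Δ ∘- F)) (sym (instantiate b))
        (wait-elementary (Resources ++ Δ) (b ≐ goal) (equations-choice-free eqs) tt
          λ M ρ s → es M ρ (equations-elementary eqs (proj₂ (proj₂ (proj₂ s))))))
    where
    instantiate : ∀ b → subst z b (var z ≐ goal) ≡ (b ≐ goal)
    instantiate b rewrite eqb-refl z = cong (b ≐_) (substT-fresh z b goal λ m → n≮n z (≤-<-trans (m≤m⊔n z 2) (ur m)))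

freeT-substT-var : ∀ v y t {w} → w ∈ freeT (substT v (var y) t) → w ≡ y ⊎ (w ∈ freeT t × w ≢ v)
freeT-substT-var-++ : ∀ v y t u {w} → w ∈ freeT (substT v (var y) t) ++ freeT (substT v (var y) u) →
  w ≡ y ⊎ (w ∈ freeT t ++ freeT u × w ≢ v)
freeT-substT-var v y (var x) m with v ≟ x
... | yes refl rewrite eqb-refl v with m
...   | here refl = inj₁ refl
freeT-substT-var v y (var x) m | no v≢x rewrite eqb-≢ v≢x with m
...   | here refl = inj₂ (here refl , v≢x ∘ sym)
freeT-substT-var v y (t ′) m = freeT-substT-var v y t m
freeT-substT-var v y (t ⊕ u) m = freeT-substT-var-++ v y t u m
freeT-substT-var v y (t ⊗ u) m = freeT-substT-var-++ v y t u m

freeT-substT-var-++ v y t u m with ∈-++⁻ (freeT (substT v (var y) t)) m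
... | inj₁ p = Sum.map₂ (Prod.map₁ ∈-++⁺ˡ) (freeT-substT-var v y t p)
... | inj₂ p = Sum.map₂ (Prod.map₁ (∈-++⁺ʳ (freeT t))) (freeT-substT-var v y u p)

remove-∈⁻ : ∀ v xs {w} → w ∈ remove v xs → w ∈ xs × w ≢ v
remove-∈⁻ v (y ∷ ys) m with v ≟ y
... | yes refl rewrite eqb-refl v = Prod.map₁ there (remove-∈⁻ v ys m)
... | no v≢y rewrite eqb-≢ v≢y with m
...   | here refl = here refl , v≢y ∘ sym
...   | there m' = Prod.map₁ there (remove-∈⁻ v ys m')

remove-∈⁺ : ∀ v xs {w} → w ∈ xs → w ≢ v → w ∈ remove v xs
remove-∈⁺ v (y ∷ ys) m w≢v with v ≟ y
... | yes refl rewrite eqb-refl v with m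
...   | here refl = ⊥-elim (w≢v refl)
...   | there m' = remove-∈⁺ v ys m' w≢v
remove-∈⁺ v (y ∷ ys) m w≢v | no v≢y rewrite eqb-≢ v≢y with m
...   | here refl = here refl
...   | there m' = there (remove-∈⁺ v ys m' w≢v)

free-⊓prefix : ∀ vs F {w} → w ∈ free (foldr ⊓x F vs) → w ∈ free F × ¬ w ∈ vs
free-⊓prefix [] F m = m , λ ()
free-⊓prefix (v ∷ vs) F m =
  let m' , w≢v = remove-∈⁻ v (free (foldr ⊓x F vs)) m
      mF , w∉vs = free-⊓prefix vs F m'
  in mF , λ { (here e) → w≢v e ; (there p) → w∉vs p }

⊓closure-sentence : ∀ F → Sentence (⊓closure F)
⊓closure-sentence F = no-members (λ m → let mF , w∉ = free-⊓prefix (freeDistinct F) F m in w∉ (∈-deduplicate⁺ _≟_ mF))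
  where
  no-members : ∀ {xs : List Var} → (∀ {w} → ¬ w ∈ xs) → xs ≡ []
  no-members {[]} _ = refl
  no-members {x ∷ xs} f = ⊥-elim (f (here refl))

subst-⊓prefix : ∀ v s z t vs → ¬ v ∈ vs → v ≢ z →
  subst v s (foldr ⊓x (⊔x z (var z ≐ t)) vs) ≡ foldr ⊓x (⊔x z (var z ≐ substT v s t)) vs
subst-⊓prefix v s z t [] _ v≢z rewrite eqb-≢ v≢z = refl
subst-⊓prefix v s z t (w ∷ vs) v∉ v≢z rewrite eqb-≢ {v} {w} (v∉ ∘ here) =
  cong (⊓x w) (subst-⊓prefix v s z t vs (v∉ ∘ there) v≢z)

binder∈⊓prefix : ∀ z A vs → z ∈ bound (foldr ⊓x (⊔x z A) vs)
binder∈⊓prefix z A [] = here refl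
binder∈⊓prefix z A (v ∷ vs) = there (binder∈⊓prefix z A vs)

-- Each variable of the ⊓-prefix is answered by a fresh variable above the
-- reserved ones, so that the matrix becomes an evaluation problem.
⊓prefix-from-resources : ∀ z vs t → Unique vs → (∀ {v} → v ∈ vs → v ≢ z) →
  (∀ {w} → w ∈ freeT t → w ∈ vs ⊎ z ⊔ℕ 2 < w) →
  CL12⊢ (Resources ∘- foldr ⊓x (⊔x z (var z ≐ t)) vs)
⊓prefix-from-resources z [] t _ _ h = Evaluation.solve-goal z t λ m → [ (λ ()) , id ] (h m)
⊓prefix-from-resources z (v ∷ vs) t (v∉vs ∷ uniq) v≢z h =
  wait-⊓x Resources ∙ v (foldr ⊓x (⊔x z (var z ≐ t)) vs) y tt tt (newVar-fresh X) (λ _ _ _ → tt)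
    (≡subst (λ F → CL12⊢ (Resources ∘- F)) (sym (subst-⊓prefix v (var y) z t vs (λ m → All.lookup v∉vs m refl) (v≢z (here refl))))
      (⊓prefix-from-resources z vs (substT v (var y) t) uniq (v≢z ∘ there) h'))
  where
  X = Resources ∘- ⊓x v (foldr ⊓x (⊔x z (var z ≐ t)) vs)
  y = newVar X
  y-unreserved : z ⊔ℕ 2 < y
  y-unreserved = ⊔-lub (occurs⇒<newVar X (_ , here refl , ∈-++⁺ʳ (free (⊓x v (foldr ⊓x (⊔x z (var z ≐ t)) vs))) (there (binder∈⊓prefix z _ vs))))
                       (occurs⇒<newVar X (_ , there (there (here refl)) , there (there (here refl))))
  h' : ∀ {w} → w ∈ freeT (substT v (var y) t) → w ∈ vs ⊎ z ⊔ℕ 2 < w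
  h' m with freeT-substT-var v y t m
  ... | inj₁ refl = inj₂ y-unreserved
  ... | inj₂ (q , w≢v) with h q
  ...   | inj₁ (here e) = ⊥-elim (w≢v e)
  ...   | inj₁ (there r) = inj₁ r
  ...   | inj₂ lt = inj₂ lt

by-logical-consequence : ∀ {Γ F} → All CLA4⊢ Γ → All Sentence Γ → Sentence F → CL12⊢ (Γ ∘- F) → CLA4⊢ F
by-logical-consequence {Γ} {F} ⊢Γ sΓ = logical-consequence Γ F (All.lookup ⊢Γ) (All.lookup sΓ)

+-identityˡ-φ +-sucˡ-φ +-comm-φ +-assoc-φ double-φ *-distribˡ-+-φ : Formula
+-identityˡ-φ = (‘0’ ⊕ var 0) ≐ var 0
+-sucˡ-φ = ((var 1 ′) ⊕ var 0) ≐ ((var 1 ⊕ var 0) ′)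
+-comm-φ = (var 1 ⊕ var 0) ≐ (var 0 ⊕ var 1)
+-assoc-φ = ((var 1 ⊕ var 2) ⊕ var 0) ≐ (var 1 ⊕ (var 2 ⊕ var 0))
double-φ = (two ⊗ var 0) ≐ (var 0 ⊕ var 0)
*-distribˡ-+-φ = (var 1 ⊗ (var 2 ⊕ var 0)) ≐ ((var 1 ⊗ var 2) ⊕ (var 1 ⊗ var 0))

Induction : Var → Formula → Formula
Induction x F = (subst x ‘0’ F ∧' ∀' x (F ⇒ subst x (var x ′) F)) ⇒ ∀' x F

PA-base : List Formula
PA-base = ∀' x₀ ((var x₀ ⊕ ‘0’) ≐ var x₀)
        ∷ ∀' x₀ (∀' y₀ ((var x₀ ⊕ (var y₀ ′)) ≐ ((var x₀ ⊕ var y₀) ′)))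
        ∷ ∀' x₀ ((var x₀ ⊗ ‘0’) ≐ ‘0’)
        ∷ ∀' x₀ (∀' y₀ ((var x₀ ⊗ (var y₀ ′)) ≐ ((var x₀ ⊗ var y₀) ⊕ var x₀)))
        ∷ map (∀closure ∘ Induction 0) (+-identityˡ-φ ∷ +-sucˡ-φ ∷ +-comm-φ ∷ +-assoc-φ ∷ double-φ ∷ *-distribˡ-+-φ ∷ [])

PA-base-provable : All CLA4⊢ PA-base
PA-base-provable = axiom ax3 ∷ axiom ax4 ∷ axiom ax5 ∷ axiom ax6
  ∷ axiom (ax-ind 0 +-identityˡ-φ tt) ∷ axiom (ax-ind 0 +-sucˡ-φ tt) ∷ axiom (ax-ind 0 +-comm-φ tt)
  ∷ axiom (ax-ind 0 +-assoc-φ tt) ∷ axiom (ax-ind 0 double-φ tt) ∷ axiom (ax-ind 0 *-distribˡ-+-φ tt) ∷ []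

PA-base-sentences : All Sentence PA-base
PA-base-sentences = refl ∷ refl ∷ refl ∷ refl ∷ refl ∷ refl ∷ refl ∷ refl ∷ refl ∷ refl ∷ []

Sat-induction : ∀ M ρ x F → Sat M ρ (Induction x F) → Sat M ρ (subst x ‘0’ F) →
  (∀ d → Sat M (update ρ x d) F → Sat M (update ρ x d) (subst x (var x ′) F)) →
  ∀ d → Sat M (update ρ x d) F
Sat-induction M ρ x F h base step =
  ⇒-elim M ρ (subst x ‘0’ F ∧' ∀' x (F ⇒ subst x (var x ′) F)) (∀' x F) h (base , λ d → ⇒-intro M (update ρ x d) F (subst x (var x ′) F) (step d))

record ArithmeticLaws (M : Structure) : Set where
  private
    infixl 6 _+ᴹ_
    infixl 7 _*ᴹ_
    _+ᴹ_ = add M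
    _*ᴹ_ = mul M
    0ᴹ = zer M
    sᴹ = suc' M
  field
    add-zero : ∀ a → a +ᴹ 0ᴹ ≈ a
    add-suc : ∀ a b → a +ᴹ sᴹ b ≈ sᴹ (a +ᴹ b)
    mul-zero : ∀ a → a *ᴹ 0ᴹ ≈ 0ᴹ
    mul-suc : ∀ a b → a *ᴹ sᴹ b ≈ a *ᴹ b +ᴹ a
    zero-add : ∀ a → 0ᴹ +ᴹ a ≈ a
    suc-add : ∀ a b → sᴹ a +ᴹ b ≈ sᴹ (a +ᴹ b)
    add-comm : ∀ a b → a +ᴹ b ≈ b +ᴹ a
    add-assoc : ∀ a b c → (a +ᴹ b) +ᴹ c ≈ a +ᴹ (b +ᴹ c)
    double : ∀ a → sᴹ (sᴹ 0ᴹ) *ᴹ a ≈ a +ᴹ a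
    mul-distrib-add : ∀ x a b → x *ᴹ (a +ᴹ b) ≈ x *ᴹ a +ᴹ x *ᴹ b

PA-laws : ∀ M ρ Γ → AllSat M ρ (map ‖_‖ (PA-base ++ Γ)) → ArithmeticLaws M
PA-laws M ρ Γ (add-zero , add-suc , mul-zero , mul-suc , h-zero-add , h-suc-add , h-comm , h-assoc , h-double , h-distrib , _) =
  record { add-zero = add-zero ; add-suc = add-suc ; mul-zero = mul-zero ; mul-suc = mul-suc ; zero-add = zero-add
         ; suc-add = suc-add ; add-comm = add-comm ; add-assoc = add-assoc ; double = double ; mul-distrib-add = mul-distrib-add }
  where
  infixl 6 _+ᴹ_
  infixl 7 _*ᴹ_
  _+ᴹ_ = add M
  _*ᴹ_ = mul M
  0ᴹ = zer M
  sᴹ = suc' M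
  zero-add : ∀ a → 0ᴹ +ᴹ a ≈ a
  zero-add = Sat-induction M ρ 0 +-identityˡ-φ h-zero-add (add-zero 0ᴹ) (λ d ih → ≈-trans (add-suc 0ᴹ d) (≈-cong sᴹ ih))
  suc-add : ∀ a b → sᴹ a +ᴹ b ≈ sᴹ (a +ᴹ b)
  suc-add a = Sat-induction M (update ρ 1 a) 0 +-sucˡ-φ (h-suc-add a) (≈-trans (add-zero (sᴹ a)) (≈-cong sᴹ (≈-sym (add-zero a))))
    (λ d ih → ≈-trans (add-suc (sᴹ a) d) (≈-trans (≈-cong sᴹ ih) (≈-cong sᴹ (≈-sym (add-suc a d)))))
  add-comm : ∀ a b → a +ᴹ b ≈ b +ᴹ a
  add-comm a = Sat-induction M (update ρ 1 a) 0 +-comm-φ (h-comm a) (≈-trans (add-zero a) (≈-sym (zero-add a)))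
    (λ d ih → ≈-trans (add-suc a d) (≈-trans (≈-cong sᴹ ih) (≈-sym (suc-add d a))))
  add-assoc : ∀ a b c → (a +ᴹ b) +ᴹ c ≈ a +ᴹ (b +ᴹ c)
  add-assoc a b = Sat-induction M (update (update ρ 1 a) 2 b) 0 +-assoc-φ (h-assoc a b)
    (≈-trans (add-zero (a +ᴹ b)) (≈-cong (a +ᴹ_) (≈-sym (add-zero b))))
    (λ d ih → ≈-trans (add-suc (a +ᴹ b) d) (≈-trans (≈-cong sᴹ ih) (≈-trans (≈-sym (add-suc a (b +ᴹ d))) (≈-cong (a +ᴹ_) (≈-sym (add-suc b d))))))
  double : ∀ a → sᴹ (sᴹ 0ᴹ) *ᴹ a ≈ a +ᴹ a
  double = Sat-induction M ρ 0 double-φ h-double (≈-trans (mul-zero (sᴹ (sᴹ 0ᴹ))) (≈-sym (add-zero 0ᴹ)))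
    (λ d ih → ≈-trans (mul-suc (sᴹ (sᴹ 0ᴹ)) d) (≈-trans (≈-cong (_+ᴹ sᴹ (sᴹ 0ᴹ)) ih)
       (≈-trans (add-suc (d +ᴹ d) (sᴹ 0ᴹ)) (≈-trans (≈-cong sᴹ (≈-trans (add-suc (d +ᴹ d) 0ᴹ) (≈-cong sᴹ (add-zero (d +ᴹ d)))))
         (≈-sym (≈-trans (suc-add d (sᴹ d)) (≈-cong sᴹ (add-suc d d))))))))
  mul-distrib-add : ∀ x a b → x *ᴹ (a +ᴹ b) ≈ x *ᴹ a +ᴹ x *ᴹ b
  mul-distrib-add x a = Sat-induction M (update (update ρ 1 x) 2 a) 0 *-distribˡ-+-φ (h-distrib x a)
    (≈-trans (≈-cong (x *ᴹ_) (add-zero a)) (≈-sym (≈-trans (≈-cong (x *ᴹ a +ᴹ_) (mul-zero x)) (add-zero (x *ᴹ a)))))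
    (λ d ih → ≈-trans (≈-cong (x *ᴹ_) (add-suc a d)) (≈-trans (mul-suc x (a +ᴹ d)) (≈-trans (≈-cong (_+ᴹ x) ih)
       (≈-trans (add-assoc (x *ᴹ a) (x *ᴹ d) x) (≈-cong (x *ᴹ a +ᴹ_) (≈-sym (mul-suc x d)))))))

⌊n+n/2⌋≡n : ∀ n → ⌊ n + n /2⌋ ≡ n
⌊n+n/2⌋≡n zero = refl
⌊n+n/2⌋≡n (suc n) rewrite +-suc n n = cong suc (⌊n+n/2⌋≡n n)

2^suc : ∀ k → 2 ^ suc k ≡ 2 ^ k + 2 ^ k
2^suc k = cong (2 ^ k +_) (+-identityʳ (2 ^ k))

⌈log₂1+2^n⌉≡1+n : ∀ n → ⌈log₂ suc (2 ^ n) ⌉ ≡ suc n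
⌈log₂1+2^n⌉≡1+n zero = refl
⌈log₂1+2^n⌉≡1+n (suc n) = begin
  ⌈log₂ suc (2 ^ suc n) ⌉                ≡⟨ m∸n+n≡m {n = 1} 1≤ ⟨
  (⌈log₂ suc (2 ^ suc n) ⌉ ∸ 1) + 1     ≡⟨ cong (_+ 1) (⌈log₂⌈n/2⌉⌉≡⌈log₂n⌉∸1 (suc (2 ^ suc n))) ⟨
  ⌈log₂ ⌈ suc (2 ^ suc n) /2⌉ ⌉ + 1      ≡⟨ cong (λ u → ⌈log₂ u ⌉ + 1) half ⟩
  ⌈log₂ suc (2 ^ n) ⌉ + 1                ≡⟨ cong (_+ 1) (⌈log₂1+2^n⌉≡1+n n) ⟩
  suc n + 1                              ≡⟨ +-comm (suc n) 1 ⟩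
  suc (suc n)                            ∎
  where
  open ≡-Reasoning
  half : ⌈ suc (2 ^ suc n) /2⌉ ≡ suc (2 ^ n)
  half rewrite 2^suc n = cong suc (⌊n+n/2⌋≡n (2 ^ n))
  1≤ : 1 ≤ ⌈log₂ suc (2 ^ suc n) ⌉
  1≤ = ⌈log₂⌉-mono-≤ (s≤s (m^n>0 2 (suc n)))

<2^⇒∣∣≤ : ∀ x k → x < 2 ^ k → ∣ x ∣ ≤ k
<2^⇒∣∣≤ x k lt = ≤-trans (⌈log₂⌉-mono-≤ lt) (≤-reflexive (⌈log₂2^n⌉≡n k))

∣∣≤⇒<2^ : ∀ x k → ∣ x ∣ ≤ k → x < 2 ^ k
∣∣≤⇒<2^ x k le with x <? 2 ^ k
... | yes lt = lt
... | no ≮ = ⊥-elim (<⇒≱ (s≤s le) (begin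
  suc k                      ≡⟨ ⌈log₂1+2^n⌉≡1+n k ⟨
  ⌈log₂ suc (2 ^ k) ⌉        ≤⟨ ⌈log₂⌉-mono-≤ (s≤s (≮⇒≥ ≮)) ⟩
  ∣ x ∣                      ∎))
  where open ≤-Reasoning

<2^∣∣ : ∀ x → x < 2 ^ ∣ x ∣
<2^∣∣ x = ∣∣≤⇒<2^ x ∣ x ∣ ≤-refl

∣∣-mono-≤ : ∀ {x y} → x ≤ y → ∣ x ∣ ≤ ∣ y ∣
∣∣-mono-≤ le = ⌈log₂⌉-mono-≤ (s≤s le)

+-<-* : ∀ {a b A B} → a < A → b < B → a + b < A * B
+-<-* {a} {b} {suc A} {suc B} (s≤s a≤A) (s≤s b≤B) = s≤s (begin
  a + b              ≤⟨ +-mono-≤ a≤A b≤B ⟩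
  A + B              ≤⟨ m≤m+n (A + B) (A * B) ⟩
  A + B + A * B      ≡⟨ cong (_+ A * B) (+-comm A B) ⟩
  B + A + A * B      ≡⟨ +-assoc B A (A * B) ⟩
  B + (A + A * B)    ≡⟨ cong (B +_) (*-suc A B) ⟨
  B + A * suc B      ∎)
  where open ≤-Reasoning

∣x+y∣≤∣x∣+∣y∣ : ∀ x y → ∣ x + y ∣ ≤ ∣ x ∣ + ∣ y ∣
∣x+y∣≤∣x∣+∣y∣ x y = <2^⇒∣∣≤ (x + y) (∣ x ∣ + ∣ y ∣)
  (≤-trans (+-<-* (<2^∣∣ x) (<2^∣∣ y)) (≤-reflexive (sym (^-distribˡ-+-* 2 ∣ x ∣ ∣ y ∣))))

∣x*y∣≤∣x∣+∣y∣ : ∀ x y → ∣ x * y ∣ ≤ ∣ x ∣ + ∣ y ∣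
∣x*y∣≤∣x∣+∣y∣ x y = <2^⇒∣∣≤ (x * y) (∣ x ∣ + ∣ y ∣)
  (≤-trans (*-mono-< (<2^∣∣ x) (<2^∣∣ y)) (≤-reflexive (sym (^-distribˡ-+-* 2 ∣ x ∣ ∣ y ∣))))

Even : ℕ → Set
Even d = Σ ℕ λ f → d ≡ f + f

even? : ∀ d → Dec (Even d)
even? d = map′ 2∣⇒even even⇒2∣ (2 ∣? d)
  where
  f+f≡f*2 : ∀ f → f + f ≡ f * 2
  f+f≡f*2 f = trans (cong (f +_) (sym (+-identityʳ f))) (*-comm 2 f)
  2∣⇒even : ∀ {d} → 2 ∣ d → Even d
  2∣⇒even (divides f refl) = f , sym (f+f≡f*2 f)
  even⇒2∣ : ∀ {d} → Even d → 2 ∣ d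
  even⇒2∣ (f , refl) = divides f (f+f≡f*2 f)

-- The arithmetical reading of the formula IsPowerOf2 below.
OneOrEvenFactors : ℕ → Set
OneOrEvenFactors n = ∀ d e → d * e ≡ n → d ≡ 1 ⊎ Even d

2^-one-or-even-factors : ∀ k → OneOrEvenFactors (2 ^ k)
2^-one-or-even-factors zero d e eq = inj₁ (m*n≡1⇒m≡1 d e eq)
2^-one-or-even-factors (suc k) d e eq
  with euclidsLemma d e (from-yes (prime? 2)) (divides (2 ^ k) (trans eq (*-comm 2 (2 ^ k))))
... | inj₁ (divides f refl) = inj₂ (f , trans (*-comm f 2) (cong (f +_) (+-identityʳ f)))
... | inj₂ (divides q refl) = 2^-one-or-even-factors k d q (*-cancelˡ-≡ (d * q) (2 ^ k) 2 (begin
  2 * (d * q)     ≡⟨ *-assoc 2 d q ⟨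
  2 * d * q       ≡⟨ cong (_* q) (*-comm 2 d) ⟩
  d * 2 * q       ≡⟨ *-assoc d 2 q ⟩
  d * (2 * q)     ≡⟨ cong (d *_) (*-comm 2 q) ⟩
  d * (q * 2)     ≡⟨ eq ⟩
  2 ^ suc k       ∎))
  where open ≡-Reasoning

one-or-even-factors⇒2^ : ∀ n → OneOrEvenFactors n → Σ ℕ λ k → n ≡ 2 ^ k
one-or-even-factors⇒2^ = <-rec _ go
  where
  go : ∀ n → (∀ {m} → m < n → OneOrEvenFactors m → Σ ℕ λ k → m ≡ 2 ^ k) → OneOrEvenFactors n → Σ ℕ λ k → n ≡ 2 ^ k
  go zero _ p with p 3 0 refl
  ... | inj₁ ()
  ... | inj₂ even-3 = ⊥-elim (from-no (even? 3) even-3)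
  go (suc zero) _ _ = 0 , refl
  go (suc (suc n)) rec p with p (suc (suc n)) 1 (*-identityʳ _)
  ... | inj₁ ()
  ... | inj₂ (zero , ())
  ... | inj₂ (suc f , e) with rec (≤-trans (m<m+n (suc f) (s≤s z≤n)) (≤-reflexive (sym e)))
                                  (λ d e' eq → p d (e' + e') (trans (*-distribˡ-+ d e' e') (trans (cong₂ _+_ eq eq) (sym e))))
  ...   | k , f≡2^k = suc k , trans e (trans (cong₂ _+_ f≡2^k f≡2^k) (sym (2^suc k)))

vK vD vE vF vQ vR : Var
vK = 100
vD = 101
vE = 102
vF = 103
vQ = 104
vR = 105

LessThan : Term → Term → Formula
LessThan a b = ∃' vK ((a ⊕ (var vK ′)) ≐ b)

FactorOf : Term → Formula
FactorOf q = (var vD ⊗ var vE) ≐ q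

OneOrEven : Formula
OneOrEven = (var vD ≐ (‘0’ ′)) ∨' ∃' vF (var vD ≐ (var vF ⊕ var vF))

IsPowerOf2 : Term → Formula
IsPowerOf2 q = ∀' vD (∀' vE (FactorOf q ⇒ OneOrEven))

-- |a| ≤ |b|, as: every power of 2 above b is above a.
LenLe : Term → Term → Formula
LenLe a b = ∀' vQ (IsPowerOf2 (var vQ) ⇒ (LessThan b (var vQ) ⇒ LessThan a (var vQ)))

-- |a| ≤ |b| + |c|, as: a is below the product of any powers of 2 above b and c.
LenLeSum : Term → Term → Term → Formula
LenLeSum a b c = ∀' vQ (∀' vR (IsPowerOf2 (var vQ) ⇒ (IsPowerOf2 (var vR) ⇒
  (LessThan b (var vQ) ⇒ (LessThan c (var vR) ⇒ LessThan a (var vQ ⊗ var vR))))))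

evalT-update : ∀ M ρ x d t → ¬ x ∈ freeT t → evalT M (update ρ x d) t ≡ evalT M ρ t
evalT-update M ρ x d (var y) x∉ rewrite eqb-≢ {x} {y} (x∉ ∘ here) = refl
evalT-update M ρ x d ‘0’ _ = refl
evalT-update M ρ x d (t ′) x∉ = cong (suc' M) (evalT-update M ρ x d t x∉)
evalT-update M ρ x d (t ⊕ u) x∉ =
  cong₂ (add M) (evalT-update M ρ x d t (x∉ ∘ ∈-++⁺ˡ)) (evalT-update M ρ x d u (x∉ ∘ ∈-++⁺ʳ (freeT t)))
evalT-update M ρ x d (t ⊗ u) x∉ =
  cong₂ (mul M) (evalT-update M ρ x d t (x∉ ∘ ∈-++⁺ˡ)) (evalT-update M ρ x d u (x∉ ∘ ∈-++⁺ʳ (freeT t)))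

-- t mentions none of the variables bound in the formulas above
AuxFree : Term → Set
AuxFree t = T (not (any (100 ≤ᵇ_) (freeT t)))

auxFree⇒∉ : ∀ {x} t → AuxFree t → 100 ≤ x → ¬ x ∈ freeT t
auxFree⇒∉ t h le m = T-not⇒¬T h (any⁺ _ (Any.map (λ { refl → ≤⇒≤ᵇ le }) m))

evalT-update-aux : ∀ M ρ x d t → AuxFree t → 100 ≤ x → evalT M (update ρ x d) t ≡ evalT M ρ t
evalT-update-aux M ρ x d t h le = evalT-update M ρ x d t (auxFree⇒∉ t h le)

module _ where
  private
    ℕ⊨ = Sat ℕ-model

  Sat-LessThan⇒< : ∀ ρ a b → ¬ vK ∈ freeT a → ¬ vK ∈ freeT b → ℕ⊨ ρ (LessThan a b) → evalℕ ρ a < evalℕ ρ b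
  Sat-LessThan⇒< ρ a b a∌ b∌ s with evalℕ ρ a <? evalℕ ρ b
  ... | yes lt = lt
  ... | no ≮ = ⊥-elim (s λ k ¬¬e → ¬¬e λ e → ≮ (witness k e))
    where
    witness : ∀ k → evalℕ (update ρ vK k) a + suc k ≡ evalℕ (update ρ vK k) b → evalℕ ρ a < evalℕ ρ b
    witness k e rewrite evalT-update ℕ-model ρ vK k a a∌ | evalT-update ℕ-model ρ vK k b b∌ =
      ≤-trans (m<m+n _ (s≤s z≤n)) (≤-reflexive e)

  <⇒Sat-LessThan : ∀ ρ a b → ¬ vK ∈ freeT a → ¬ vK ∈ freeT b → evalℕ ρ a < evalℕ ρ b → ℕ⊨ ρ (LessThan a b)
  <⇒Sat-LessThan ρ a b a∌ b∌ lt no-witness = no-witness k λ ¬e → ¬e witness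
    where
    k = evalℕ ρ b ∸ suc (evalℕ ρ a)
    witness : evalℕ (update ρ vK k) a + suc k ≡ evalℕ (update ρ vK k) b
    witness rewrite evalT-update ℕ-model ρ vK k a a∌ | evalT-update ℕ-model ρ vK k b b∌ =
      trans (+-suc (evalℕ ρ a) k) (m+[n∸m]≡n lt)

  Sat-IsPowerOf2⇒2^ : ∀ ρ q → ¬ vD ∈ freeT q → ¬ vE ∈ freeT q → ℕ⊨ ρ (IsPowerOf2 q) → Σ ℕ λ k → evalℕ ρ q ≡ 2 ^ k
  Sat-IsPowerOf2⇒2^ ρ q q∌vD q∌vE s = one-or-even-factors⇒2^ (evalℕ ρ q) λ d e eq →
    one-or-even {d} {e} (⇒-elim ℕ-model (ρ′ d e) (FactorOf q) OneOrEven (s d e) λ ¬eq → ¬eq (trans eq (sym (eval-q d e))))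
    where
    ρ′ : ℕ → ℕ → Var → ℕ
    ρ′ d e = update (update ρ vD d) vE e
    eval-q : ∀ d e → evalℕ (ρ′ d e) q ≡ evalℕ ρ q
    eval-q d e = trans (evalT-update ℕ-model _ vE e q q∌vE) (evalT-update ℕ-model ρ vD d q q∌vD)
    one-or-even : ∀ {d e} → ℕ⊨ (ρ′ d e) OneOrEven → d ≡ 1 ⊎ Even d
    one-or-even {d} s′ with d ≟ 1 | even? d
    ... | yes d≡1 | _ = inj₁ d≡1
    ... | no _ | yes ev = inj₂ ev
    ... | no d≢1 | no odd = ⊥-elim (s′ ((λ ¬¬e → ¬¬e d≢1) , λ ex → ex λ f ¬¬e → ¬¬e λ e → odd (f , e)))

  2^⇒Sat-IsPowerOf2 : ∀ ρ q k → ¬ vD ∈ freeT q → ¬ vE ∈ freeT q → evalℕ ρ q ≡ 2 ^ k → ℕ⊨ ρ (IsPowerOf2 q)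
  2^⇒Sat-IsPowerOf2 ρ q k q∌vD q∌vE q≡2^k d e =
    ⇒-intro ℕ-model ρ′ (FactorOf q) OneOrEven λ ¬¬eq → Sat-stable ℕ-model ρ′ OneOrEven λ ¬goal → ¬¬eq λ eq →
      ¬goal (one-or-even (2^-one-or-even-factors k d e (trans eq (trans eval-q q≡2^k))))
    where
    ρ′ = update (update ρ vD d) vE e
    eval-q : evalℕ ρ′ q ≡ evalℕ ρ q
    eval-q = trans (evalT-update ℕ-model _ vE e q q∌vE) (evalT-update ℕ-model ρ vD d q q∌vD)
    one-or-even : d ≡ 1 ⊎ Even d → ℕ⊨ ρ′ OneOrEven
    one-or-even (inj₁ d≡1) (¬one , _) = ¬one λ ¬e → ¬e d≡1
    one-or-even (inj₂ (f , e)) (_ , ¬even) = ¬even λ no-f → no-f f λ ¬e → ¬e e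

  private
    100≤vQ : 100 ≤ vQ
    100≤vQ = ≤ᵇ⇒≤ 100 vQ tt
    100≤vR : 100 ≤ vR
    100≤vR = ≤ᵇ⇒≤ 100 vR tt
    vK∉Q : ¬ vK ∈ freeT (var vQ)
    vK∉Q (here ())
    vK∉R : ¬ vK ∈ freeT (var vR)
    vK∉R (here ())
    vK∉QR : ¬ vK ∈ freeT (var vQ ⊗ var vR)
    vK∉QR (here ())
    vK∉QR (there (here ()))

  Sat-LenLe⇒ : ∀ ρ a b → AuxFree a → AuxFree b → ℕ⊨ ρ (LenLe a b) → ∣ evalℕ ρ a ∣ ≤ ∣ evalℕ ρ b ∣
  Sat-LenLe⇒ ρ a b ha hb s = <2^⇒∣∣≤ _ k (≡subst (_< 2 ^ k) (eval a ha)
    (Sat-LessThan⇒< ρQ a (var vQ) (auxFree⇒∉ a ha (≤ᵇ⇒≤ 100 vK tt)) vK∉Q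
      (⇒-elim ℕ-model ρQ (LessThan b (var vQ)) (LessThan a (var vQ))
        (⇒-elim ℕ-model ρQ (IsPowerOf2 (var vQ)) (LessThan b (var vQ) ⇒ LessThan a (var vQ)) (s (2 ^ k)) (2^⇒Sat-IsPowerOf2 ρQ (var vQ) k (λ { (here ()) }) (λ { (here ()) }) refl))
        (<⇒Sat-LessThan ρQ b (var vQ) (auxFree⇒∉ b hb (≤ᵇ⇒≤ 100 vK tt)) vK∉Q (≡subst (_< 2 ^ k) (sym (eval b hb)) (<2^∣∣ _))))))
    where
    k = ∣ evalℕ ρ b ∣
    ρQ = update ρ vQ (2 ^ k)
    eval : ∀ t → AuxFree t → evalℕ ρQ t ≡ evalℕ ρ t
    eval t h = evalT-update-aux ℕ-model ρ vQ _ t h 100≤vQ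

  ∣∣≤⇒Sat-LenLe : ∀ ρ a b → AuxFree a → AuxFree b → ∣ evalℕ ρ a ∣ ≤ ∣ evalℕ ρ b ∣ → ℕ⊨ ρ (LenLe a b)
  ∣∣≤⇒Sat-LenLe ρ a b ha hb le Q =
    ⇒-intro ℕ-model ρQ (IsPowerOf2 (var vQ)) (LessThan b (var vQ) ⇒ LessThan a (var vQ)) λ pow →
    ⇒-intro ℕ-model ρQ (LessThan b (var vQ)) (LessThan a (var vQ)) λ b<Q →
    let k , Q≡2^k = Sat-IsPowerOf2⇒2^ ρQ (var vQ) (λ { (here ()) }) (λ { (here ()) }) pow
    in <⇒Sat-LessThan ρQ a (var vQ) (auxFree⇒∉ a ha (≤ᵇ⇒≤ 100 vK tt)) vK∉Q
         (≡subst₂ _<_ (sym (eval a ha)) (sym Q≡2^k)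
           (∣∣≤⇒<2^ _ k (≤-trans le (<2^⇒∣∣≤ _ k (≡subst₂ _<_ (eval b hb) Q≡2^k
             (Sat-LessThan⇒< ρQ b (var vQ) (auxFree⇒∉ b hb (≤ᵇ⇒≤ 100 vK tt)) vK∉Q b<Q))))))
    where
    ρQ = update ρ vQ Q
    eval : ∀ t → AuxFree t → evalℕ ρQ t ≡ evalℕ ρ t
    eval t h = evalT-update-aux ℕ-model ρ vQ Q t h 100≤vQ

  Sat-LenLeSum⇒ : ∀ ρ a b c → AuxFree a → AuxFree b → AuxFree c →
    ℕ⊨ ρ (LenLeSum a b c) → ∣ evalℕ ρ a ∣ ≤ ∣ evalℕ ρ b ∣ + ∣ evalℕ ρ c ∣
  Sat-LenLeSum⇒ ρ a b c ha hb hc s = <2^⇒∣∣≤ _ (i + j) (≡subst₂ _<_ (eval a ha) (sym (^-distribˡ-+-* 2 i j))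
    (Sat-LessThan⇒< ρQR a (var vQ ⊗ var vR) (auxFree⇒∉ a ha (≤ᵇ⇒≤ 100 vK tt)) vK∉QR
      (⇒-elim ℕ-model ρQR (LessThan c (var vR)) (LessThan a (var vQ ⊗ var vR))
      (⇒-elim ℕ-model ρQR (LessThan b (var vQ)) (LessThan c (var vR) ⇒ LessThan a (var vQ ⊗ var vR))
      (⇒-elim ℕ-model ρQR (IsPowerOf2 (var vR)) (LessThan b (var vQ) ⇒ (LessThan c (var vR) ⇒ LessThan a (var vQ ⊗ var vR)))
      (⇒-elim ℕ-model ρQR (IsPowerOf2 (var vQ)) (IsPowerOf2 (var vR) ⇒ (LessThan b (var vQ) ⇒ (LessThan c (var vR) ⇒ LessThan a (var vQ ⊗ var vR)))) (s (2 ^ i) (2 ^ j))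
        (2^⇒Sat-IsPowerOf2 ρQR (var vQ) i (λ { (here ()) }) (λ { (here ()) }) refl))
        (2^⇒Sat-IsPowerOf2 ρQR (var vR) j (λ { (here ()) }) (λ { (here ()) }) refl))
        (<⇒Sat-LessThan ρQR b (var vQ) (auxFree⇒∉ b hb (≤ᵇ⇒≤ 100 vK tt)) vK∉Q (≡subst (_< 2 ^ i) (sym (eval b hb)) (<2^∣∣ _))))
        (<⇒Sat-LessThan ρQR c (var vR) (auxFree⇒∉ c hc (≤ᵇ⇒≤ 100 vK tt)) vK∉R (≡subst (_< 2 ^ j) (sym (eval c hc)) (<2^∣∣ _))))))
    where
    i = ∣ evalℕ ρ b ∣
    j = ∣ evalℕ ρ c ∣
    ρQR = update (update ρ vQ (2 ^ i)) vR (2 ^ j)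
    eval : ∀ t → AuxFree t → evalℕ ρQR t ≡ evalℕ ρ t
    eval t h = trans (evalT-update-aux ℕ-model _ vR _ t h 100≤vR) (evalT-update-aux ℕ-model ρ vQ _ t h 100≤vQ)

  ∣∣≤⇒Sat-LenLeSum : ∀ ρ a b c → AuxFree a → AuxFree b → AuxFree c →
    ∣ evalℕ ρ a ∣ ≤ ∣ evalℕ ρ b ∣ + ∣ evalℕ ρ c ∣ → ℕ⊨ ρ (LenLeSum a b c)
  ∣∣≤⇒Sat-LenLeSum ρ a b c ha hb hc le Q R =
    ⇒-intro ℕ-model ρQR (IsPowerOf2 (var vQ)) (IsPowerOf2 (var vR) ⇒ (LessThan b (var vQ) ⇒ (LessThan c (var vR) ⇒ LessThan a (var vQ ⊗ var vR)))) λ powQ →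
    ⇒-intro ℕ-model ρQR (IsPowerOf2 (var vR)) (LessThan b (var vQ) ⇒ (LessThan c (var vR) ⇒ LessThan a (var vQ ⊗ var vR))) λ powR →
    ⇒-intro ℕ-model ρQR (LessThan b (var vQ)) (LessThan c (var vR) ⇒ LessThan a (var vQ ⊗ var vR)) λ b<Q →
    ⇒-intro ℕ-model ρQR (LessThan c (var vR)) (LessThan a (var vQ ⊗ var vR)) λ c<R →
    let i , Q≡2^i = Sat-IsPowerOf2⇒2^ ρQR (var vQ) (λ { (here ()) }) (λ { (here ()) }) powQ
        j , R≡2^j = Sat-IsPowerOf2⇒2^ ρQR (var vR) (λ { (here ()) }) (λ { (here ()) }) powR
        ∣b∣≤i = <2^⇒∣∣≤ _ i (≡subst₂ _<_ (eval b hb) Q≡2^i (Sat-LessThan⇒< ρQR b (var vQ) (auxFree⇒∉ b hb (≤ᵇ⇒≤ 100 vK tt)) vK∉Q b<Q))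
        ∣c∣≤j = <2^⇒∣∣≤ _ j (≡subst₂ _<_ (eval c hc) R≡2^j (Sat-LessThan⇒< ρQR c (var vR) (auxFree⇒∉ c hc (≤ᵇ⇒≤ 100 vK tt)) vK∉R c<R))
    in <⇒Sat-LessThan ρQR a (var vQ ⊗ var vR) (auxFree⇒∉ a ha (≤ᵇ⇒≤ 100 vK tt)) vK∉QR
         (≡subst₂ _<_ (sym (eval a ha)) (trans (^-distribˡ-+-* 2 i j) (sym (cong₂ _*_ Q≡2^i R≡2^j)))
           (∣∣≤⇒<2^ _ (i + j) (≤-trans le (+-mono-≤ ∣b∣≤i ∣c∣≤j))))
    where
    ρQR = update (update ρ vQ Q) vR R
    eval : ∀ t → AuxFree t → evalℕ ρQR t ≡ evalℕ ρ t
    eval t h = trans (evalT-update-aux ℕ-model _ vR R t h 100≤vR) (evalT-update-aux ℕ-model ρ vQ Q t h 100≤vQ)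

-- The choice quantifiers carry the size bounds that
-- polynomial boundedness demands, each disguised as a disjunction
-- "z = value ∨ |z| ≤ bound": it is a sizebound in ℕ since |x+y|, |x·y| ≤ |x|+|y|,
-- and inside the proofs it holds by its first disjunct.
hX hU : Var
hX = 10
hU = 11

Half₀ Half₁ : Formula
Half₀ = var hX ≐ (var hU ·0)
Half₁ = var hX ≐ (var hU ·1)

HalfSize : Formula
HalfSize = (Half₀ ∨' Half₁) ∨' LenLe (var hU) (var hX)

HalfMatrix : Formula
HalfMatrix = HalfSize ∧' (Half₀ ⊔ Half₁)

Halving : Formula
Halving = ⊔x hU HalfMatrix

aY aX aW aZ : Var
aY = 20
aX = 21
aW = 22
aZ = 23

AddInputBound : Formula
AddInputBound = LenLe (var aX) (var aW)

SumEq : Formula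
SumEq = var aZ ≐ (var aX ⊕ var aY)

SumSize : Formula
SumSize = SumEq ∨' LenLeSum (var aZ) (var aX) (var aY)

AddMatrix : Formula
AddMatrix = AddInputBound ⇒ ⊔x aZ (SumSize ∧' SumEq)

AddInduction : Formula
AddInduction = ⊓x aX AddMatrix

mY mX mZ : Var
mY = 30
mX = 31
mZ = 32

ProductEq : Formula
ProductEq = var mZ ≐ (var mX ⊗ var mY)

ProductSize : Formula
ProductSize = ProductEq ∨' LenLeSum (var mZ) (var mX) (var mY)

ProductMatrix : Formula
ProductMatrix = ProductSize ∧' ProductEq

MulInduction : Formula
MulInduction = ⊔x mZ ProductMatrix

isElementary : Formula → Bool
isElementary (A ∧' B) = isElementary A ∧ isElementary B
isElementary (A ∨' B) = isElementary A ∧ isElementary B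
isElementary (A ⊓ B) = false
isElementary (A ⊔ B) = false
isElementary (∀' x A) = isElementary A
isElementary (∃' x A) = isElementary A
isElementary (⊓x x A) = false
isElementary (⊔x x A) = false
isElementary _ = true

isElementary-sound : ∀ F → T (isElementary F) → Elementary F × PolyBounded F
isElementary-sound ⊤' _ = tt , tt
isElementary-sound ⊥' _ = tt , tt
isElementary-sound (t ≐ u) _ = tt , tt
isElementary-sound (t ≠ u) _ = tt , tt
isElementary-sound (A ∧' B) h = binary A B h
  where
  binary : ∀ A B → T (isElementary A ∧ isElementary B) → (Elementary A × Elementary B) × (PolyBounded A × PolyBounded B)
  binary A B h = let eA , pA = isElementary-sound A (T-∧₁ h) ; eB , pB = isElementary-sound B (T-∧₂ {isElementary A} h)
                 in (eA , eB) , (pA , pB)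
isElementary-sound (A ∨' B) h =
  let eA , pA = isElementary-sound A (T-∧₁ h) ; eB , pB = isElementary-sound B (T-∧₂ {isElementary A} h)
  in (eA , eB) , (pA , pB)
isElementary-sound (∀' x A) h = isElementary-sound A h
isElementary-sound (∃' x A) h = isElementary-sound A h

polyBounded : ∀ F → T (isElementary F) → PolyBounded F
polyBounded F h = proj₂ (isElementary-sound F h)

LenLe-sizebound : ∀ x y → AuxFree (var x) → AuxFree (var y) → x ≢ y → SizeBound x (LenLe (var x) (var y))
LenLe-sizebound x y hx hy x≢y = proj₁ (isElementary-sound (LenLe (var x) (var y)) tt) , var y , (λ { (here e) → x≢y e })
  , λ ρ → mk⇔ (Sat-LenLe⇒ ρ (var x) (var y) hx hy) (∣∣≤⇒Sat-LenLe ρ (var x) (var y) hx hy)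

LenLeSum-sizebound : ∀ x y w → AuxFree (var x) → AuxFree (var y) → AuxFree (var w) → x ≢ y → x ≢ w →
  SizeBound x (LenLeSum (var x) (var y) (var w))
LenLeSum-sizebound x y w hx hy hw x≢y x≢w =
  proj₁ (isElementary-sound (LenLeSum (var x) (var y) (var w)) tt) , var y ⊕ var w ,
  (λ { (here e) → x≢y e ; (there (here e)) → x≢w e }) ,
  λ ρ → mk⇔ (Sat-LenLeSum⇒ ρ (var x) (var y) (var w) hx hy hw) (∣∣≤⇒Sat-LenLeSum ρ (var x) (var y) (var w) hx hy hw)

∨-sizebound : ∀ {x E S} → T (isElementary E) → (sb : SizeBound x S) →
  (∀ ρ → Sat ℕ-model ρ E → ∣ ρ x ∣ ≤ evalℕ (λ v → ∣ ρ v ∣) (proj₁ (proj₂ sb))) → SizeBound x (E ∨' S)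
∨-sizebound {x} {E} {S} hE (elS , τ , x∉τ , S⇔) E⇒bound =
  (proj₁ (isElementary-sound E hE) , elS) , τ , x∉τ , λ ρ → mk⇔
    (λ s → decidable-stable (_ ≤? _) λ ¬bound →
      s ((λ e → ¬bound (E⇒bound ρ e)) , λ sS → ¬bound (Equivalence.to (S⇔ ρ) sS)))
    (λ bound → ∨-introʳ ℕ-model ρ E S (Equivalence.from (S⇔ ρ) bound))

≈⇒≡ : ∀ {a b : ℕ} → a ≈ b → a ≡ b
≈⇒≡ = decidable-stable (_ ≟ _)

HalfSize-sizebound : SizeBound hU HalfSize
HalfSize-sizebound = ∨-sizebound {E = Half₀ ∨' Half₁} {S = LenLe (var hU) (var hX)} tt (LenLe-sizebound hU hX tt tt (λ ())) λ ρ s →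
  decidable-stable (_ ≤? _) λ ¬bound →
    s ((λ x≈2u → ¬bound (∣∣-mono-≤ {ρ hU} (≤-trans (u≤2u _) (≤-reflexive (sym (≈⇒≡ x≈2u))))))
      , (λ x≈2u+1 → ¬bound (∣∣-mono-≤ {ρ hU} (≤-trans (≤-trans (u≤2u _) (n≤1+n _)) (≤-reflexive (sym (≈⇒≡ x≈2u+1)))))))
  where
  u≤2u : ∀ u → u ≤ 2 * u
  u≤2u u = m≤m+n u (u + 0)

SumSize-sizebound : SizeBound aZ SumSize
SumSize-sizebound = ∨-sizebound {E = SumEq} {S = LenLeSum (var aZ) (var aX) (var aY)} tt (LenLeSum-sizebound aZ aX aY tt tt tt (λ ()) (λ ())) λ ρ z≈x+y →
  ≤-trans (≤-reflexive (cong ∣_∣ (≈⇒≡ z≈x+y))) (∣x+y∣≤∣x∣+∣y∣ (ρ aX) (ρ aY))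

ProductSize-sizebound : SizeBound mZ ProductSize
ProductSize-sizebound = ∨-sizebound {E = ProductEq} {S = LenLeSum (var mZ) (var mX) (var mY)} tt (LenLeSum-sizebound mZ mX mY tt tt tt (λ ()) (λ ())) λ ρ z≈x*y →
  ≤-trans (≤-reflexive (cong ∣_∣ (≈⇒≡ z≈x*y))) (∣x*y∣≤∣x∣+∣y∣ (ρ mX) (ρ mY))

Halving-polyBounded : PolyBounded Halving
Halving-polyBounded = (polyBounded HalfSize tt , tt , tt) , HalfSize , _ , HalfSize-sizebound , refl

AddInduction-polyBounded : PolyBounded AddInduction
AddInduction-polyBounded = (polyBounded (neg AddInputBound) tt , (polyBounded SumSize tt , tt) , SumSize , _ , SumSize-sizebound , refl) ,
                 AddInputBound , _ , LenLe-sizebound aX aW tt tt (λ ()) , refl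

MulInduction-polyBounded : PolyBounded MulInduction
MulInduction-polyBounded = (polyBounded ProductSize tt , tt) , ProductSize , _ , ProductSize-sizebound , refl

halving-base : CL12⊢ (PA-base ∘- subst hX ‘0’ Halving)
halving-base = ⊔x-choose ∙ hU (s0 HalfMatrix) ‘0’ (inj₁ refl)
  (⊔-choose (_ ∧ᵣ ∙) (s00 Half₀) (s00 Half₁) false
    (wait-elementary PA-base (s00 HalfSize ∧' s00 Half₀) tt tt (λ M ρ s →
       let F = PA-laws M ρ [] s in
       (λ { (na , _) → na (λ { (nb , _) → nb (≈-sym (ArithmeticLaws.mul-zero F _)) }) }) , ≈-sym (ArithmeticLaws.mul-zero F _))))
  where
  s0 s00 : Formula → Formula
  s0 F = subst hX ‘0’ F
  s00 F = subst hU ‘0’ (subst hX ‘0’ F)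

-- The half of x0 and of x1 is x itself, so the premise Halving(x) is never queried.
halving-step₀ : CL12⊢ (PA-base ∘- ⊓closure (Halving ⇒ subst hX (var hX ·0) Halving))
halving-step₀ =
  wait-⊓x PA-base ∙ hX (neg Halving ∨' subst hX (var hX ·0) Halving) 40 tt tt (not-mentioned⇒fresh 40 _ tt) (λ _ _ _ → tt)
  (⊔x-choose (_ ∨ᵣ ∙) hU (σ (τ0 HalfMatrix)) (var 40) (not-mentioned⇒admissible 40 _ tt)
  (⊔-choose (_ ∨ᵣ (_ ∧ᵣ ∙)) (ρ40 (σ (τ0 Half₀))) (ρ40 (σ (τ0 Half₁))) false
  (wait-⊓x PA-base (∙ ∨ₗ _) hU (σ (neg HalfMatrix)) 41 tt tt (not-mentioned⇒fresh 41 _ tt) (λ _ _ _ → λ { (n , _) → n tt })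
  (wait-⊓ PA-base ((_ ∨ᵣ ∙) ∨ₗ _) (ν (neg Half₀)) (ν (neg Half₁)) tt tt (λ _ _ _ → λ { (n , _) → n (λ { (_ , m) → m tt }) })
    (wait-elementary PA-base _ tt tt λ M ρ s → λ { (_ , nr) → nr (r {M} {ρ}) })
    (wait-elementary PA-base _ tt tt λ M ρ s → λ { (_ , nr) → nr (r {M} {ρ}) })))))
  where
  σ τ0 ρ40 ν : Formula → Formula
  σ = subst hX (var 40)
  τ0 = subst hX (var hX ·0)
  ρ40 = subst hU (var 40)
  ν F = subst hU (var 41) (σ F)
  r : ∀ {M ρ} → Sat M ρ (ρ40 (σ (τ0 HalfSize)) ∧' ρ40 (σ (τ0 Half₀)))
  r = (λ { (na , _) → na (λ { (nb , _) → nb ≈-refl }) }) , ≈-refl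

halving-step₁ : CL12⊢ (PA-base ∘- ⊓closure (Halving ⇒ subst hX (var hX ·1) Halving))
halving-step₁ =
  wait-⊓x PA-base ∙ hX (neg Halving ∨' subst hX (var hX ·1) Halving) 40 tt tt (not-mentioned⇒fresh 40 _ tt) (λ _ _ _ → tt)
  (⊔x-choose (_ ∨ᵣ ∙) hU (σ (τ1 HalfMatrix)) (var 40) (not-mentioned⇒admissible 40 _ tt)
  (⊔-choose (_ ∨ᵣ (_ ∧ᵣ ∙)) (ρ40 (σ (τ1 Half₀))) (ρ40 (σ (τ1 Half₁))) true
  (wait-⊓x PA-base (∙ ∨ₗ _) hU (σ (neg HalfMatrix)) 41 tt tt (not-mentioned⇒fresh 41 _ tt) (λ _ _ _ → λ { (n , _) → n tt })
  (wait-⊓ PA-base ((_ ∨ᵣ ∙) ∨ₗ _) (ν (neg Half₀)) (ν (neg Half₁)) tt tt (λ _ _ _ → λ { (n , _) → n (λ { (_ , m) → m tt }) })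
    (wait-elementary PA-base _ tt tt λ M ρ s → λ { (_ , nr) → nr (r {M} {ρ}) })
    (wait-elementary PA-base _ tt tt λ M ρ s → λ { (_ , nr) → nr (r {M} {ρ}) })))))
  where
  σ τ1 ρ40 ν : Formula → Formula
  σ = subst hX (var 40)
  τ1 = subst hX (var hX ·1)
  ρ40 = subst hU (var 40)
  ν F = subst hU (var 41) (σ F)
  r : ∀ {M ρ} → Sat M ρ (ρ40 (σ (τ1 HalfSize)) ∧' ρ40 (σ (τ1 Half₁)))
  r = (λ { (na , _) → na (λ { (_ , nb) → nb ≈-refl }) }) , ≈-refl

⊢halving : CLA4⊢ (⊓closure Halving)
⊢halving = induction hX Halving Halving-polyBounded
  (by-logical-consequence PA-base-provable PA-base-sentences refl halving-base)
  (by-logical-consequence PA-base-provable PA-base-sentences refl halving-step₀)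
  (by-logical-consequence PA-base-provable PA-base-sentences refl halving-step₁)

module _ (M : Structure) (laws : ArithmeticLaws M) where
  open ArithmeticLaws laws
  private
    infixl 6 _+ᴹ_
    infixl 7 _*ᴹ_
    _+ᴹ_ = add M
    _*ᴹ_ = mul M
    sᴹ = suc' M
    2ᴹ = sᴹ (sᴹ (zer M))

  LenLe-antitoneˡ : ∀ ρ a a' b → AuxFree a → AuxFree a' → (k : D M) →
    evalT M ρ a' +ᴹ k ≈ evalT M ρ a → Sat M ρ (LenLe a b) → Sat M ρ (LenLe a' b)
  LenLe-antitoneˡ ρ a a' b ha ha' k a'+k≈a a≤b Q =
    ⇒-intro M ρQ (IsPowerOf2 (var vQ)) (LessThan b (var vQ) ⇒ LessThan a' (var vQ)) λ pow →
    ⇒-intro M ρQ (LessThan b (var vQ)) (LessThan a' (var vQ)) λ b<Q →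
    below (⇒-elim M ρQ (LessThan b (var vQ)) (LessThan a (var vQ))
            (⇒-elim M ρQ (IsPowerOf2 (var vQ)) (LessThan b (var vQ) ⇒ LessThan a (var vQ)) (a≤b Q) pow) b<Q)
    where
    ρQ = update ρ vQ Q
    eval : ∀ c t → AuxFree t → evalT M (update ρQ vK c) t ≡ evalT M ρ t
    eval c t h = trans (evalT-update-aux M ρQ vK c t h ≤-refl) (evalT-update-aux M ρ vQ Q t h (≤ᵇ⇒≤ 100 vQ tt))
    below : Sat M ρQ (LessThan a (var vQ)) → Sat M ρQ (LessThan a' (var vQ))
    below a<Q no-witness = a<Q λ k' a+k'<Q → no-witness (k +ᴹ k')
      (≈-trans (≈-cong (_+ᴹ sᴹ (k +ᴹ k')) (≡⇒≈ (eval (k +ᴹ k') a' ha')))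
      (≈-trans (add-suc _ _)
      (≈-trans (≈-cong sᴹ (≈-sym (add-assoc _ _ _)))
      (≈-trans (≈-cong (λ u → sᴹ (u +ᴹ k')) a'+k≈a)
      (≈-trans (≈-sym (add-suc _ _))
      (≈-trans (≈-cong (_+ᴹ sᴹ k') (≡⇒≈ (sym (eval k' a ha)))) a+k'<Q))))))

  double-sum : ∀ u → u +ᴹ u ≈ 2ᴹ *ᴹ u
  double-sum u = ≈-sym (double u)

  double-sum-suc : ∀ u → u +ᴹ sᴹ u ≈ sᴹ (2ᴹ *ᴹ u)
  double-sum-suc u = ≈-trans (add-suc u u) (≈-cong sᴹ (double-sum u))

  add-interchange : ∀ a b c d → (a +ᴹ b) +ᴹ (c +ᴹ d) ≈ (a +ᴹ c) +ᴹ (b +ᴹ d)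
  add-interchange a b c d =
    ≈-trans (add-assoc a b (c +ᴹ d)) (≈-trans (≈-cong (a +ᴹ_) (≈-sym (add-assoc b c d)))
    (≈-trans (≈-cong (λ u → a +ᴹ (u +ᴹ d)) (add-comm b c)) (≈-trans (≈-cong (a +ᴹ_) (add-assoc c b d)) (≈-sym (add-assoc a c (b +ᴹ d))))))

  double-distrib-add : ∀ a b → 2ᴹ *ᴹ (a +ᴹ b) ≈ 2ᴹ *ᴹ a +ᴹ 2ᴹ *ᴹ b
  double-distrib-add a b = ≈-trans (double (a +ᴹ b)) (≈-trans (add-interchange a b a b) (≈-cong₂ _+ᴹ_ (double-sum a) (double-sum b)))

  double-mul : ∀ x y → 2ᴹ *ᴹ (x *ᴹ y) ≈ x *ᴹ (2ᴹ *ᴹ y)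
  double-mul x y = ≈-trans (double _) (≈-trans (≈-sym (mul-distrib-add _ _ _)) (≈-cong (x *ᴹ_) (≈-sym (double _))))

  double-suc : ∀ a → 2ᴹ *ᴹ sᴹ a ≈ sᴹ (sᴹ (2ᴹ *ᴹ a))
  double-suc a = ≈-trans (mul-suc 2ᴹ a) (≈-trans (add-suc _ _) (≈-cong sᴹ (≈-trans (add-suc _ _) (≈-cong sᴹ (add-zero _)))))

Doubling : Formula
Doubling = ⊓x 0 (⊔x 1 (var 1 ≐ (var 0 ·0)))

addition-base : CL12⊢ (PA-base ∘- ⊓closure (subst aY ‘0’ AddInduction))
addition-base =
  wait-⊓x PA-base ∙ aW (subst aY ‘0’ AddInduction) 40 tt tt (not-mentioned⇒fresh 40 _ tt) (λ _ _ _ → tt)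
  (wait-⊓x PA-base ∙ aX (σ (s0 AddMatrix)) 41 tt tt (not-mentioned⇒fresh 41 _ tt) (λ _ _ _ → tt)
  (⊔x-choose (_ ∨ᵣ ∙) aZ (π (SumSize ∧' SumEq)) (var 41) (not-mentioned⇒admissible 41 _ tt)
  (wait-elementary PA-base _ tt tt λ M ρ s → let F = PA-laws M ρ [] s ; e = ≈-sym (ArithmeticLaws.add-zero F (ρ 41)) in
     λ { (_ , nr) → nr ((λ { (na , _) → na e }) , e) })))
  where
  s0 σ π : Formula → Formula
  s0 = subst aY ‘0’
  σ F = subst aW (var 40) F
  π F = subst aX (var 41) (σ (s0 F))

-- In the induction step, 40 is the bound w, 41 the y of x + y0 (or x + y1),
-- 42 the x, 43 the half u of x (from Halving), 44 the sum u + y (from the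
-- induction hypothesis), and 45, 46 the answers of Successor and Doubling that
-- rebuild x + y0 = 2(u + y) + (x mod 2), resp. x + y1.
AdditionStepContext AdditionStepBase : List Formula
AdditionStepContext = PA-base ++ Successor ∷ Doubling ∷ (⊓closure Halving) ∷ []
AdditionStepBase = PA-base ++ Successor ∷ Doubling ∷ []

σ π ξ κ μ λ43 : Formula → Formula
σ F = subst aW (var 40) F
π F = subst aY (var 41) (σ F)
ξ F = subst aX (var 42) (π F)
κ F = subst hX (var 42) F
μ F = subst hU (var 43) (κ F)
λ43 F = subst aX (var 43) (π F)

τ0 τ1 : Formula → Formula
τ0 = subst aY (var aY ·0)
τ1 = subst aY (var aY ·1)

Sa42 Sa43 : Formula
Sa42 = LenLe (var 42) (var 40)
Sa43 = LenLe (var 43) (var 40)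

addition-step₀ : 
  CL12⊢ (AdditionStepBase ++ (μ HalfSize ∧' μ Half₀) ∷ [] ∘- π (neg AddInduction) ∨' ξ (τ0 AddMatrix)) →
  CL12⊢ (AdditionStepBase ++ (μ HalfSize ∧' μ Half₁) ∷ [] ∘- π (neg AddInduction) ∨' ξ (τ0 AddMatrix)) →
  CL12⊢ (AdditionStepContext ∘- ⊓x aW (⊓x aY (neg AddInduction ∨' ⊓x aX (τ0 AddMatrix))))
addition-step₀ D0 D1 =
  wait-⊓x AdditionStepContext ∙ aW (⊓x aY (neg AddInduction ∨' ⊓x aX (τ0 AddMatrix))) 40 tt tt (not-mentioned⇒fresh 40 _ tt) (λ _ _ _ → tt)
  (wait-⊓x AdditionStepContext ∙ aY (σ (neg AddInduction ∨' ⊓x aX (τ0 AddMatrix))) 41 tt tt (not-mentioned⇒fresh 41 _ tt) (λ _ _ _ → tt)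
  (wait-⊓x AdditionStepContext (_ ∨ᵣ ∙) aX (π (τ0 AddMatrix)) 42 tt tt (not-mentioned⇒fresh 42 _ tt) (λ _ _ _ → λ { (_ , n) → n tt })
  (⊓x-choose {G = AdditionStepBase} {K = []} ∙ hX Halving (var 42) (not-mentioned⇒admissible 42 _ tt)
  (wait-⊔x AdditionStepBase [] ∙ hU (κ HalfMatrix) _ 43 tt tt tt tt (not-mentioned⇒fresh 43 _ tt) (λ M ρ s → ⊥-elim (Sat-last M ρ AdditionStepBase (⊔x hU (κ HalfMatrix)) s))
  (wait-⊔ AdditionStepBase [] (_ ∧ᵣ ∙) (μ Half₀) (μ Half₁) _ tt tt tt tt (λ M ρ s → ⊥-elim (proj₂ (Sat-last M ρ AdditionStepBase (μ HalfSize ∧' (μ Half₀ ⊔ μ Half₁)) s)))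
     D0 D1)))))

addition-step₁ : 
  CL12⊢ (AdditionStepBase ++ (μ HalfSize ∧' μ Half₀) ∷ [] ∘- π (neg AddInduction) ∨' ξ (τ1 AddMatrix)) →
  CL12⊢ (AdditionStepBase ++ (μ HalfSize ∧' μ Half₁) ∷ [] ∘- π (neg AddInduction) ∨' ξ (τ1 AddMatrix)) →
  CL12⊢ (AdditionStepContext ∘- ⊓x aW (⊓x aY (neg AddInduction ∨' ⊓x aX (τ1 AddMatrix))))
addition-step₁ D0 D1 =
  wait-⊓x AdditionStepContext ∙ aW (⊓x aY (neg AddInduction ∨' ⊓x aX (τ1 AddMatrix))) 40 tt tt (not-mentioned⇒fresh 40 _ tt) (λ _ _ _ → tt)
  (wait-⊓x AdditionStepContext ∙ aY (σ (neg AddInduction ∨' ⊓x aX (τ1 AddMatrix))) 41 tt tt (not-mentioned⇒fresh 41 _ tt) (λ _ _ _ → tt)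
  (wait-⊓x AdditionStepContext (_ ∨ᵣ ∙) aX (π (τ1 AddMatrix)) 42 tt tt (not-mentioned⇒fresh 42 _ tt) (λ _ _ _ → λ { (_ , n) → n tt })
  (⊓x-choose {G = AdditionStepBase} {K = []} ∙ hX Halving (var 42) (not-mentioned⇒admissible 42 _ tt)
  (wait-⊔x AdditionStepBase [] ∙ hU (κ HalfMatrix) _ 43 tt tt tt tt (not-mentioned⇒fresh 43 _ tt) (λ M ρ s → ⊥-elim (Sat-last M ρ AdditionStepBase (⊔x hU (κ HalfMatrix)) s))
  (wait-⊔ AdditionStepBase [] (_ ∧ᵣ ∙) (μ Half₀) (μ Half₁) _ tt tt tt tt (λ M ρ s → ⊥-elim (proj₂ (Sat-last M ρ AdditionStepBase (μ HalfSize ∧' (μ Half₀ ⊔ μ Half₁)) s)))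
     D0 D1)))))

module _ (M : Structure) (F : ArithmeticLaws M) (ρ : Var → D M) where
  2ᴰ : D M
  2ᴰ = suc' M (suc' M (zer M))
  input-bound-antitone : ∀ k → add M (ρ 43) k ≈ ρ 42 → Sat M ρ Sa42 → Sat M ρ Sa43
  input-bound-antitone k e = LenLe-antitoneˡ M F ρ (var 42) (var 43) (var 40) tt tt k e
  even-half-sum : ρ 42 ≈ mul M 2ᴰ (ρ 43) → add M (ρ 43) (ρ 43) ≈ ρ 42
  even-half-sum h = ≈-trans (double-sum M F (ρ 43)) (≈-sym h)
  odd-half-sum : ρ 42 ≈ suc' M (mul M 2ᴰ (ρ 43)) → add M (ρ 43) (suc' M (ρ 43)) ≈ ρ 42
  odd-half-sum h = ≈-trans (double-sum-suc M F (ρ 43)) (≈-sym h)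

HalfAnswer₀ HalfAnswer₁ : Formula
HalfAnswer₀ = μ HalfSize ∧' μ Half₀
HalfAnswer₁ = μ HalfSize ∧' μ Half₁

half-input-bound : ∀ (b : Bool) → let Eh = (if b then HalfAnswer₁ else HalfAnswer₀) in ∀ M ρ → AllSat M ρ (map ‖_‖ (AdditionStepBase ++ Eh ∷ [])) →
  (Sat M ρ Sa42 → Sat M ρ Sa43)
half-input-bound false M ρ s = input-bound-antitone M F ρ (ρ 43) (even-half-sum M F ρ (proj₂ (Sat-last M ρ AdditionStepBase HalfAnswer₀ s)))
  where F = PA-laws M ρ (Successor ∷ Doubling ∷ HalfAnswer₀ ∷ []) s
half-input-bound true M ρ s = input-bound-antitone M F ρ (suc' M (ρ 43)) (odd-half-sum M F ρ (proj₂ (Sat-last M ρ AdditionStepBase HalfAnswer₁ s)))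
  where F = PA-laws M ρ (Successor ∷ Doubling ∷ HalfAnswer₁ ∷ []) s

addition-step₀-even : CL12⊢ (AdditionStepBase ++ HalfAnswer₀ ∷ [] ∘- π (neg AddInduction) ∨' ξ (τ0 AddMatrix))
addition-step₀-even =
  ⊔x-choose (∙ ∨ₗ _) aX (π (neg AddMatrix)) (var 43) (not-mentioned⇒admissible 43 _ tt)
  (wait-⊓x (AdditionStepBase ++ HalfAnswer₀ ∷ []) ((_ ∧ᵣ ∙) ∨ₗ _) aZ (λ43 (neg (SumSize ∧' SumEq))) 44 tt tt (not-mentioned⇒fresh 44 _ tt)
     (λ M ρ s → λ { (nA , nB) → nB (λ { (nn , _) → nA (half-input-bound false M ρ s (¬Sat-neg⇒Sat M ρ Sa42 nn) , tt) }) })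
  (⊓x-choose {G = PA-base ++ Successor ∷ []} {K = HalfAnswer₀ ∷ []} ∙ 0 (⊔x 1 (var 1 ≐ (var 0 ·0))) (var 44) (not-mentioned⇒admissible 44 _ tt)
  (wait-⊔x (PA-base ++ Successor ∷ []) (HalfAnswer₀ ∷ []) ∙ 1 (var 1 ≐ (var 44 ·0)) _ 45 tt tt tt tt (not-mentioned⇒fresh 45 _ tt)
     (λ M ρ s → ⊥-elim (Sat-middle M ρ (PA-base ++ Successor ∷ []) (⊔x 1 (var 1 ≐ (var 44 ·0))) (HalfAnswer₀ ∷ []) s))
  (⊔x-choose (_ ∨ᵣ (_ ∨ᵣ ∙)) aZ (ξ (τ0 (SumSize ∧' SumEq))) (var 45) (not-mentioned⇒admissible 45 _ tt)
  (wait-elementary _ _ tt tt λ M ρ s →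
     let F = PA-laws M ρ (Successor ∷ (var 45 ≐ (var 44 ·0)) ∷ HalfAnswer₀ ∷ []) s
         d45 = Sat-middle M ρ (PA-base ++ Successor ∷ []) (var 45 ≐ (var 44 ·0)) (HalfAnswer₀ ∷ []) s
         eh = Sat-last M ρ ((PA-base ++ Successor ∷ []) ++ (var 45 ≐ (var 44 ·0)) ∷ []) HalfAnswer₀ s
         h0 = proj₂ eh
     in λ { (nA , nB) → nB (λ { (nn , nx) → nA (input-bound-antitone M F ρ (ρ 43) (even-half-sum M F ρ h0) (¬Sat-neg⇒Sat M ρ Sa42 nn) ,
           λ { (_ , nne) → let eq = ≈-trans d45 (≈-trans (≈-cong (mul M (2ᴰ M F ρ)) nne)
                                      (≈-trans (double-distrib-add M F _ _) (≈-cong (λ u → add M u (mul M (2ᴰ M F ρ) (ρ 41))) (≈-sym h0))))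
                           in nx ((λ { (na , _) → na eq }) , eq) }) }) })))))

S46 D45 S45 D46 : Formula
S46 = var 46 ≐ (var 45 ′)
D45 = var 45 ≐ (var 44 ·0)
S45 = var 45 ≐ (var 44 ′)
D46 = var 46 ≐ (var 45 ·0)

addition-step₀-odd : CL12⊢ (AdditionStepBase ++ HalfAnswer₁ ∷ [] ∘- π (neg AddInduction) ∨' ξ (τ0 AddMatrix))
addition-step₀-odd =
  ⊔x-choose (∙ ∨ₗ _) aX (π (neg AddMatrix)) (var 43) (not-mentioned⇒admissible 43 _ tt)
  (wait-⊓x (AdditionStepBase ++ HalfAnswer₁ ∷ []) ((_ ∧ᵣ ∙) ∨ₗ _) aZ (λ43 (neg (SumSize ∧' SumEq))) 44 tt tt (not-mentioned⇒fresh 44 _ tt)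
     (λ M ρ s → λ { (nA , nB) → nB (λ { (nn , _) → nA (half-input-bound true M ρ s (¬Sat-neg⇒Sat M ρ Sa42 nn) , tt) }) })
  (⊓x-choose {G = PA-base ++ Successor ∷ []} {K = HalfAnswer₁ ∷ []} ∙ 0 (⊔x 1 (var 1 ≐ (var 0 ·0))) (var 44) (not-mentioned⇒admissible 44 _ tt)
  (wait-⊔x (PA-base ++ Successor ∷ []) (HalfAnswer₁ ∷ []) ∙ 1 (var 1 ≐ (var 44 ·0)) _ 45 tt tt tt tt (not-mentioned⇒fresh 45 _ tt)
     (λ M ρ s → ⊥-elim (Sat-middle M ρ (PA-base ++ Successor ∷ []) (⊔x 1 (var 1 ≐ (var 44 ·0))) (HalfAnswer₁ ∷ []) s))
  (⊓x-choose {G = PA-base} {K = D45 ∷ HalfAnswer₁ ∷ []} ∙ 0 (⊔x 1 (var 1 ≐ (var 0 ′))) (var 45) (not-mentioned⇒admissible 45 _ tt)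
  (wait-⊔x PA-base (D45 ∷ HalfAnswer₁ ∷ []) ∙ 1 (var 1 ≐ (var 45 ′)) _ 46 tt tt tt tt (not-mentioned⇒fresh 46 _ tt)
     (λ M ρ s → ⊥-elim (Sat-middle M ρ PA-base (⊔x 1 (var 1 ≐ (var 45 ′))) (D45 ∷ HalfAnswer₁ ∷ []) s))
  (⊔x-choose (_ ∨ᵣ (_ ∨ᵣ ∙)) aZ (ξ (τ0 (SumSize ∧' SumEq))) (var 46) (not-mentioned⇒admissible 46 _ tt)
  (wait-elementary _ _ tt tt λ M ρ s →
     let F = PA-laws M ρ (S46 ∷ D45 ∷ HalfAnswer₁ ∷ []) s
         s46 = Sat-middle M ρ PA-base S46 (D45 ∷ HalfAnswer₁ ∷ []) s
         d45 = Sat-middle M ρ (PA-base ++ S46 ∷ []) D45 (HalfAnswer₁ ∷ []) s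
         h1 = proj₂ (Sat-last M ρ (PA-base ++ S46 ∷ D45 ∷ []) HalfAnswer₁ s)
         t = 2ᴰ M F ρ
         open ArithmeticLaws F
     in λ { (nA , nB) → nB (λ { (nn , nx) → nA (input-bound-antitone M F ρ (suc' M (ρ 43)) (odd-half-sum M F ρ h1) (¬Sat-neg⇒Sat M ρ Sa42 nn) ,
           λ { (_ , nne) → let eq = ≈-trans s46 (≈-trans (≈-cong (suc' M) d45) (≈-trans (≈-cong (λ u → suc' M (mul M t u)) nne)
                                      (≈-trans (≈-cong (suc' M) (double-distrib-add M F _ _)) (≈-trans (≈-sym (suc-add _ _))
                                        (≈-cong (λ u → add M u (mul M t (ρ 41))) (≈-sym h1))))))
                           in nx ((λ { (na , _) → na eq }) , eq) }) }) })))))))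

addition-step₁-even : CL12⊢ (AdditionStepBase ++ HalfAnswer₀ ∷ [] ∘- π (neg AddInduction) ∨' ξ (τ1 AddMatrix))
addition-step₁-even =
  ⊔x-choose (∙ ∨ₗ _) aX (π (neg AddMatrix)) (var 43) (not-mentioned⇒admissible 43 _ tt)
  (wait-⊓x (AdditionStepBase ++ HalfAnswer₀ ∷ []) ((_ ∧ᵣ ∙) ∨ₗ _) aZ (λ43 (neg (SumSize ∧' SumEq))) 44 tt tt (not-mentioned⇒fresh 44 _ tt)
     (λ M ρ s → λ { (nA , nB) → nB (λ { (nn , _) → nA (half-input-bound false M ρ s (¬Sat-neg⇒Sat M ρ Sa42 nn) , tt) }) })
  (⊓x-choose {G = PA-base ++ Successor ∷ []} {K = HalfAnswer₀ ∷ []} ∙ 0 (⊔x 1 (var 1 ≐ (var 0 ·0))) (var 44) (not-mentioned⇒admissible 44 _ tt)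
  (wait-⊔x (PA-base ++ Successor ∷ []) (HalfAnswer₀ ∷ []) ∙ 1 (var 1 ≐ (var 44 ·0)) _ 45 tt tt tt tt (not-mentioned⇒fresh 45 _ tt)
     (λ M ρ s → ⊥-elim (Sat-middle M ρ (PA-base ++ Successor ∷ []) (⊔x 1 (var 1 ≐ (var 44 ·0))) (HalfAnswer₀ ∷ []) s))
  (⊓x-choose {G = PA-base} {K = D45 ∷ HalfAnswer₀ ∷ []} ∙ 0 (⊔x 1 (var 1 ≐ (var 0 ′))) (var 45) (not-mentioned⇒admissible 45 _ tt)
  (wait-⊔x PA-base (D45 ∷ HalfAnswer₀ ∷ []) ∙ 1 (var 1 ≐ (var 45 ′)) _ 46 tt tt tt tt (not-mentioned⇒fresh 46 _ tt)
     (λ M ρ s → ⊥-elim (Sat-middle M ρ PA-base (⊔x 1 (var 1 ≐ (var 45 ′))) (D45 ∷ HalfAnswer₀ ∷ []) s))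
  (⊔x-choose (_ ∨ᵣ (_ ∨ᵣ ∙)) aZ (ξ (τ1 (SumSize ∧' SumEq))) (var 46) (not-mentioned⇒admissible 46 _ tt)
  (wait-elementary _ _ tt tt λ M ρ s →
     let F = PA-laws M ρ (S46 ∷ D45 ∷ HalfAnswer₀ ∷ []) s
         s46 = Sat-middle M ρ PA-base S46 (D45 ∷ HalfAnswer₀ ∷ []) s
         d45 = Sat-middle M ρ (PA-base ++ S46 ∷ []) D45 (HalfAnswer₀ ∷ []) s
         h0 = proj₂ (Sat-last M ρ (PA-base ++ S46 ∷ D45 ∷ []) HalfAnswer₀ s)
         t = 2ᴰ M F ρ
         open ArithmeticLaws F
     in λ { (nA , nB) → nB (λ { (nn , nx) → nA (input-bound-antitone M F ρ (ρ 43) (even-half-sum M F ρ h0) (¬Sat-neg⇒Sat M ρ Sa42 nn) ,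
           λ { (_ , nne) → let eq = ≈-trans s46 (≈-trans (≈-cong (suc' M) d45) (≈-trans (≈-cong (λ u → suc' M (mul M t u)) nne)
                                      (≈-trans (≈-cong (suc' M) (double-distrib-add M F _ _)) (≈-trans (≈-sym (add-suc _ _))
                                        (≈-cong (λ u → add M u (suc' M (mul M t (ρ 41)))) (≈-sym h0))))))
                           in nx ((λ { (na , _) → na eq }) , eq) }) }) })))))))

addition-step₁-odd : CL12⊢ (AdditionStepBase ++ HalfAnswer₁ ∷ [] ∘- π (neg AddInduction) ∨' ξ (τ1 AddMatrix))
addition-step₁-odd =
  ⊔x-choose (∙ ∨ₗ _) aX (π (neg AddMatrix)) (var 43) (not-mentioned⇒admissible 43 _ tt)
  (wait-⊓x (AdditionStepBase ++ HalfAnswer₁ ∷ []) ((_ ∧ᵣ ∙) ∨ₗ _) aZ (λ43 (neg (SumSize ∧' SumEq))) 44 tt tt (not-mentioned⇒fresh 44 _ tt)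
     (λ M ρ s → λ { (nA , nB) → nB (λ { (nn , _) → nA (half-input-bound true M ρ s (¬Sat-neg⇒Sat M ρ Sa42 nn) , tt) }) })
  (⊓x-choose {G = PA-base} {K = Doubling ∷ HalfAnswer₁ ∷ []} ∙ 0 (⊔x 1 (var 1 ≐ (var 0 ′))) (var 44) (not-mentioned⇒admissible 44 _ tt)
  (wait-⊔x PA-base (Doubling ∷ HalfAnswer₁ ∷ []) ∙ 1 (var 1 ≐ (var 44 ′)) _ 45 tt tt tt tt (not-mentioned⇒fresh 45 _ tt)
     (λ M ρ s → ⊥-elim (Sat-middle M ρ PA-base (⊔x 1 (var 1 ≐ (var 44 ′))) (Doubling ∷ HalfAnswer₁ ∷ []) s))
  (⊓x-choose {G = PA-base ++ S45 ∷ []} {K = HalfAnswer₁ ∷ []} ∙ 0 (⊔x 1 (var 1 ≐ (var 0 ·0))) (var 45) (not-mentioned⇒admissible 45 _ tt)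
  (wait-⊔x (PA-base ++ S45 ∷ []) (HalfAnswer₁ ∷ []) ∙ 1 (var 1 ≐ (var 45 ·0)) _ 46 tt tt tt tt (not-mentioned⇒fresh 46 _ tt)
     (λ M ρ s → ⊥-elim (Sat-middle M ρ (PA-base ++ S45 ∷ []) (⊔x 1 (var 1 ≐ (var 45 ·0))) (HalfAnswer₁ ∷ []) s))
  (⊔x-choose (_ ∨ᵣ (_ ∨ᵣ ∙)) aZ (ξ (τ1 (SumSize ∧' SumEq))) (var 46) (not-mentioned⇒admissible 46 _ tt)
  (wait-elementary _ _ tt tt λ M ρ s →
     let F = PA-laws M ρ (S45 ∷ D46 ∷ HalfAnswer₁ ∷ []) s
         s45 = Sat-middle M ρ PA-base S45 (D46 ∷ HalfAnswer₁ ∷ []) s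
         d46 = Sat-middle M ρ (PA-base ++ S45 ∷ []) D46 (HalfAnswer₁ ∷ []) s
         h1 = proj₂ (Sat-last M ρ (PA-base ++ S45 ∷ D46 ∷ []) HalfAnswer₁ s)
         t = 2ᴰ M F ρ
         sc = suc' M
         open ArithmeticLaws F
     in λ { (nA , nB) → nB (λ { (nn , nx) → nA (input-bound-antitone M F ρ (suc' M (ρ 43)) (odd-half-sum M F ρ h1) (¬Sat-neg⇒Sat M ρ Sa42 nn) ,
           λ { (_ , nne) → let eq = ≈-trans d46 (≈-trans (≈-cong (mul M t) s45) (≈-trans (double-suc M F _)
                                      (≈-trans (≈-cong (λ u → sc (sc (mul M t u))) nne)
                                      (≈-trans (≈-cong (λ u → sc (sc u)) (double-distrib-add M F _ _))
                                      (≈-sym (≈-trans (≈-cong (λ u → add M u (sc (mul M t (ρ 41)))) h1)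
                                         (≈-trans (add-suc _ _) (≈-cong sc (suc-add _ _)))))))))
                           in nx ((λ { (na , _) → na eq }) , eq) }) }) })))))))

AF : Formula
AF = ⊓closure AddInduction

⊢addition-induction : CLA4⊢ AF
⊢addition-induction = induction aY AddInduction AddInduction-polyBounded
  (by-logical-consequence PA-base-provable PA-base-sentences refl addition-base)
  (by-logical-consequence (++⁺ PA-base-provable (axiom ax-suc ∷ axiom ax-dbl ∷ ⊢halving ∷ []))
                          (++⁺ PA-base-sentences (refl ∷ refl ∷ refl ∷ [])) refl (addition-step₀ addition-step₀-even addition-step₀-odd))
  (by-logical-consequence (++⁺ PA-base-provable (axiom ax-suc ∷ axiom ax-dbl ∷ ⊢halving ∷ []))
                          (++⁺ PA-base-sentences (refl ∷ refl ∷ refl ∷ [])) refl (addition-step₁ addition-step₁-even addition-step₁-odd))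

LenLe-refl : ∀ M ρ a → Sat M ρ (LenLe a a)
LenLe-refl M ρ a Q =
  ⇒-intro M ρQ (IsPowerOf2 (var vQ)) (LessThan a (var vQ) ⇒ LessThan a (var vQ)) λ _ →
  ⇒-intro M ρQ (LessThan a (var vQ)) (LessThan a (var vQ)) id
  where ρQ = update ρ vQ Q

addition-from-induction : CL12⊢ (AF ∷ [] ∘- (Binary plus))
addition-from-induction =
  wait-⊓x (AF ∷ []) ∙ 0 (⊓x 1 (⊔x 2 (var 2 ≐ (var 0 ⊕ var 1)))) 50 tt tt (not-mentioned⇒fresh 50 _ tt) (λ _ _ _ → tt)
  (wait-⊓x (AF ∷ []) ∙ 1 (⊔x 2 (var 2 ≐ (var 50 ⊕ var 1))) 51 tt tt (not-mentioned⇒fresh 51 _ tt) (λ _ _ _ → tt)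
  (⊓x-choose {G = []} {K = []} ∙ aW (⊓x aY AddInduction) (var 50) (not-mentioned⇒admissible 50 _ tt)
  (⊓x-choose {G = []} {K = []} ∙ aY (ω AddInduction) (var 51) (not-mentioned⇒admissible 51 _ tt)
  (⊓x-choose {G = []} {K = []} ∙ aX (ω' AddMatrix) (var 50) (not-mentioned⇒admissible 50 _ tt)
  (wait-⊔x [] [] (_ ∨ᵣ ∙) aZ (θ (SumSize ∧' SumEq)) _ 52 tt tt tt tt (not-mentioned⇒fresh 52 _ tt)
     (λ M ρ s → ⊥-elim (proj₁ s ((λ ns → Sat-neg⇒¬Sat M ρ (LenLe (var 50) (var 50)) ns (LenLe-refl M ρ (var 50))) , (λ ()))))
  (⊔x-choose ∙ 2 (var 2 ≐ (var 50 ⊕ var 51)) (var 52) (not-mentioned⇒admissible 52 _ tt)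
  (wait-elementary _ (var 52 ≐ (var 50 ⊕ var 51)) tt tt λ M ρ s →
     λ n → proj₁ s ((λ ns → Sat-neg⇒¬Sat M ρ (LenLe (var 50) (var 50)) ns (LenLe-refl M ρ (var 50))) , (λ r → proj₂ r n)))))))))
  where
  ω ω' θ : Formula → Formula
  ω = subst aW (var 50)
  ω' F = subst aY (var 51) (ω F)
  θ F = subst aX (var 50) (ω' F)

⊢addition : CLA4⊢ (Binary plus)
⊢addition = by-logical-consequence (⊢addition-induction ∷ []) (refl ∷ []) refl addition-from-induction

multiplication-base : CL12⊢ (PA-base ∘- ⊓closure (subst mY ‘0’ MulInduction))
multiplication-base =
  wait-⊓x PA-base ∙ mX (subst mY ‘0’ MulInduction) 40 tt tt (not-mentioned⇒fresh 40 _ tt) (λ _ _ _ → tt)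
  (⊔x-choose ∙ mZ (subst mX (var 40) (subst mY ‘0’ ProductMatrix)) ‘0’ (inj₁ refl)
  (wait-elementary PA-base _ tt tt λ M ρ s → let F = PA-laws M ρ [] s ; e = ≈-sym (ArithmeticLaws.mul-zero F (ρ 40)) in
     (λ { (na , _) → na e }) , e))

MultiplicationStepContext : List Formula
MultiplicationStepContext = PA-base ++ Successor ∷ Doubling ∷ (Binary plus) ∷ []

σm πm τm0 τm1 : Formula → Formula
σm = subst mX (var 40)
πm F = subst mY (var 41) (σm F)
τm0 = subst mY (var mY ·0)
τm1 = subst mY (var mY ·1)

D43 A44 : Formula
D43 = var 43 ≐ (var 42 ·0)
A44 = var 44 ≐ (var 43 ⊕ var 40)

module _ (M : Structure) (F : ArithmeticLaws M) (ρ : Var → D M) where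
  doubled-product : ρ 43 ≈ mul M (2ᴰ M F ρ) (ρ 42) → ρ 42 ≈ mul M (ρ 40) (ρ 41) →
    ρ 43 ≈ mul M (ρ 40) (mul M (2ᴰ M F ρ) (ρ 41))
  doubled-product d e = ≈-trans d (≈-trans (≈-cong (mul M (2ᴰ M F ρ)) e) (double-mul M F (ρ 40) (ρ 41)))

multiplication-step₀ : CL12⊢ (MultiplicationStepContext ∘- ⊓closure (MulInduction ⇒ τm0 MulInduction))
multiplication-step₀ =
  wait-⊓x MultiplicationStepContext ∙ mX (⊓x mY (neg MulInduction ∨' τm0 MulInduction)) 40 tt tt (not-mentioned⇒fresh 40 _ tt) (λ _ _ _ → tt)
  (wait-⊓x MultiplicationStepContext ∙ mY (σm (neg MulInduction ∨' τm0 MulInduction)) 41 tt tt (not-mentioned⇒fresh 41 _ tt) (λ _ _ _ → tt)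
  (wait-⊓x MultiplicationStepContext (∙ ∨ₗ _) mZ (πm (neg ProductMatrix)) 42 tt tt (not-mentioned⇒fresh 42 _ tt) (λ _ _ _ → λ { (n , _) → n tt })
  (⊓x-choose {G = PA-base ++ Successor ∷ []} {K = (Binary plus) ∷ []} ∙ 0 (⊔x 1 (var 1 ≐ (var 0 ·0))) (var 42) (not-mentioned⇒admissible 42 _ tt)
  (wait-⊔x (PA-base ++ Successor ∷ []) ((Binary plus) ∷ []) ∙ 1 (var 1 ≐ (var 42 ·0)) _ 43 tt tt tt tt (not-mentioned⇒fresh 43 _ tt)
     (λ M ρ s → ⊥-elim (Sat-middle M ρ (PA-base ++ Successor ∷ []) (⊔x 1 (var 1 ≐ (var 42 ·0))) ((Binary plus) ∷ []) s))
  (⊔x-choose (_ ∨ᵣ ∙) mZ (πm (τm0 ProductMatrix)) (var 43) (not-mentioned⇒admissible 43 _ tt)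
  (wait-elementary _ _ tt tt λ M ρ s →
     let F = PA-laws M ρ (Successor ∷ D43 ∷ (Binary plus) ∷ []) s
         d43 = Sat-middle M ρ (PA-base ++ Successor ∷ []) D43 ((Binary plus) ∷ []) s
     in λ { (nA , nB) → nA (λ { (_ , nne) → let eq = doubled-product M F ρ d43 nne in nB ((λ { (na , _) → na eq }) , eq) }) }))))))

multiplication-step₁ : CL12⊢ (MultiplicationStepContext ∘- ⊓closure (MulInduction ⇒ τm1 MulInduction))
multiplication-step₁ =
  wait-⊓x MultiplicationStepContext ∙ mX (⊓x mY (neg MulInduction ∨' τm1 MulInduction)) 40 tt tt (not-mentioned⇒fresh 40 _ tt) (λ _ _ _ → tt)
  (wait-⊓x MultiplicationStepContext ∙ mY (σm (neg MulInduction ∨' τm1 MulInduction)) 41 tt tt (not-mentioned⇒fresh 41 _ tt) (λ _ _ _ → tt)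
  (wait-⊓x MultiplicationStepContext (∙ ∨ₗ _) mZ (πm (neg ProductMatrix)) 42 tt tt (not-mentioned⇒fresh 42 _ tt) (λ _ _ _ → λ { (n , _) → n tt })
  (⊓x-choose {G = PA-base ++ Successor ∷ []} {K = (Binary plus) ∷ []} ∙ 0 (⊔x 1 (var 1 ≐ (var 0 ·0))) (var 42) (not-mentioned⇒admissible 42 _ tt)
  (wait-⊔x (PA-base ++ Successor ∷ []) ((Binary plus) ∷ []) ∙ 1 (var 1 ≐ (var 42 ·0)) _ 43 tt tt tt tt (not-mentioned⇒fresh 43 _ tt)
     (λ M ρ s → ⊥-elim (Sat-middle M ρ (PA-base ++ Successor ∷ []) (⊔x 1 (var 1 ≐ (var 42 ·0))) ((Binary plus) ∷ []) s))
  (⊓x-choose {G = PA-base ++ Successor ∷ D43 ∷ []} {K = []} ∙ 0 (⊓x 1 (⊔x 2 (var 2 ≐ (var 0 ⊕ var 1)))) (var 43) (not-mentioned⇒admissible 43 _ tt)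
  (⊓x-choose {G = PA-base ++ Successor ∷ D43 ∷ []} {K = []} ∙ 1 (⊔x 2 (var 2 ≐ (var 43 ⊕ var 1))) (var 40) (not-mentioned⇒admissible 40 _ tt)
  (wait-⊔x (PA-base ++ Successor ∷ D43 ∷ []) [] ∙ 2 (var 2 ≐ (var 43 ⊕ var 40)) _ 44 tt tt tt tt (not-mentioned⇒fresh 44 _ tt)
     (λ M ρ s → ⊥-elim (Sat-last M ρ (PA-base ++ Successor ∷ D43 ∷ []) (⊔x 2 (var 2 ≐ (var 43 ⊕ var 40))) s))
  (⊔x-choose (_ ∨ᵣ ∙) mZ (πm (τm1 ProductMatrix)) (var 44) (not-mentioned⇒admissible 44 _ tt)
  (wait-elementary _ _ tt tt λ M ρ s →
     let F = PA-laws M ρ (Successor ∷ D43 ∷ A44 ∷ []) s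
         d43 = Sat-middle M ρ (PA-base ++ Successor ∷ []) D43 (A44 ∷ []) s
         a44 = Sat-last M ρ (PA-base ++ Successor ∷ D43 ∷ []) A44 s
     in λ { (nA , nB) → nA (λ { (_ , nne) →
          let eq = ≈-trans a44 (≈-trans (≈-cong (λ u → add M u (ρ 40)) (doubled-product M F ρ d43 nne)) (≈-sym (ArithmeticLaws.mul-suc F _ _)))
          in nB ((λ { (na , _) → na eq }) , eq) }) })))))))))

MF : Formula
MF = ⊓closure MulInduction

⊢multiplication-induction : CLA4⊢ MF
⊢multiplication-induction = induction mY MulInduction MulInduction-polyBounded
  (by-logical-consequence PA-base-provable PA-base-sentences refl multiplication-base)
  (by-logical-consequence (++⁺ PA-base-provable (axiom ax-suc ∷ axiom ax-dbl ∷ ⊢addition ∷ []))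
                          (++⁺ PA-base-sentences (refl ∷ refl ∷ refl ∷ [])) refl multiplication-step₀)
  (by-logical-consequence (++⁺ PA-base-provable (axiom ax-suc ∷ axiom ax-dbl ∷ ⊢addition ∷ []))
                          (++⁺ PA-base-sentences (refl ∷ refl ∷ refl ∷ [])) refl multiplication-step₁)

multiplication-from-induction : CL12⊢ (MF ∷ [] ∘- (Binary times))
multiplication-from-induction =
  wait-⊓x (MF ∷ []) ∙ 0 (⊓x 1 (⊔x 2 (var 2 ≐ (var 0 ⊗ var 1)))) 50 tt tt (not-mentioned⇒fresh 50 _ tt) (λ _ _ _ → tt)
  (wait-⊓x (MF ∷ []) ∙ 1 (⊔x 2 (var 2 ≐ (var 50 ⊗ var 1))) 51 tt tt (not-mentioned⇒fresh 51 _ tt) (λ _ _ _ → tt)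
  (⊓x-choose {G = []} {K = []} ∙ mX (⊓x mY MulInduction) (var 50) (not-mentioned⇒admissible 50 _ tt)
  (⊓x-choose {G = []} {K = []} ∙ mY (subst mX (var 50) MulInduction) (var 51) (not-mentioned⇒admissible 51 _ tt)
  (wait-⊔x [] [] ∙ mZ (subst mY (var 51) (subst mX (var 50) ProductMatrix)) _ 52 tt tt tt tt (not-mentioned⇒fresh 52 _ tt)
     (λ M ρ s → ⊥-elim (proj₁ s))
  (⊔x-choose ∙ 2 (var 2 ≐ (var 50 ⊗ var 51)) (var 52) (not-mentioned⇒admissible 52 _ tt)
  (wait-elementary _ (var 52 ≐ (var 50 ⊗ var 51)) tt tt λ M ρ s → proj₂ (proj₁ s)))))))

⊢multiplication : CLA4⊢ (Binary times)
⊢multiplication = by-logical-consequence (⊢multiplication-induction ∷ []) (refl ∷ []) refl multiplication-from-induction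

fact12p6 : (τ : Term) (z : Var) → ¬ (z ∈ freeT τ) → CLA4⊢ (⊓closure (⊔x z (var z ≐ τ)))
fact12p6 τ z z∉τ =
  by-logical-consequence (axiom ax-suc ∷ ⊢addition ∷ ⊢multiplication ∷ []) (refl ∷ refl ∷ refl ∷ []) (⊓closure-sentence B)
    (⊓prefix-from-resources z (freeDistinct B) τ (deduplicate-! (free B)) prefix≢z (inj₁ ∘ free-in-prefix))
  where
  B = ⊔x z (var z ≐ τ)
  prefix≢z : ∀ {v} → v ∈ freeDistinct B → v ≢ z
  prefix≢z m = proj₂ (remove-∈⁻ z (free (var z ≐ τ)) (∈-deduplicate⁻ _≟_ (free B) m))
  free-in-prefix : ∀ {w} → w ∈ freeT τ → w ∈ freeDistinct B
  free-in-prefix m = ∈-deduplicate⁺ _≟_ (remove-∈⁺ z (z ∷ freeT τ) (there m) λ { refl → z∉τ m })
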